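{- Every model of $\Sigma$ satisfying $\mathcal T_{\mathrm{ab}}$ satisfies every formula of $\mathcal T_{\mathrm{ab}}^\dagger=\{\phi^\dagger:\phi\in\mathcal T_{\mathrm{ab}}\}$.
   Context: Quivers. A quiver is a tuple $Q=(V_Q,A_Q,s_Q,t_Q)$ with $V_Q$, $A_Q$ finite subsets of $\mathbb N$ and $s_Q,t_Q\colon A_Q\to V_Q$. A morphism $m\colon Q\to Q'$ is a pair of maps $m_V,m_A$ compatible with sources and targets; an embedding if both are injective. $\mathrm{PQ}_k$ has vertices $\{0,\dots,k\}$, arrows $\{0,\dots,k-1\}$, arrow $i\colon i\to i+1$; nontrivial if $k\ge1$. A path of length $k$ of $Q$ is a morphism $\mathrm{PQ}_k\to Q$; $\mathcal{BP}_Q$ is the set of pairs of paths with same start and same end. $Q$ is acyclic if all its paths are embeddings; $S$ is the set of acyclic quivers. $\Sigma$ is the many-sorted first-order signature with equality $\approx$, sorts the elements of $S$, a function symbol $\mathrm{restr}_m$ from sort $Q$ to sort $Q'$ for each embedding $m\colon Q'\to Q$ of acyclic quivers, and a unary predicate $\mathrm{commute}_Q$ for each $Q\in S$. A model gives sets $\mathcal M_Q$, maps $\mathrm{restr}^{\mathcal M}_m$, subsets $\mathrm{commute}^{\mathcal M}_Q$. Duality: $Q^\dagger=(V_Q,A_Q,t_Q,s_Q)$, $m^\dagger$ has the same underlying maps as $m$, and $\phi^\dagger$ replaces every sort $Q$ (of variables and quantifiers) by $Q^\dagger$, $\mathrm{restr}_m$ by $\mathrm{restr}_{m^\dagger}$,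 $\mathrm{commute}_Q$ by $\mathrm{commute}_{Q^\dagger}$. Subquivers are identified with quivers in $S$ via fixed isomorphisms; "restriction to a subquiver" means $\mathrm{restr}$ along the corresponding embedding. Theory $\mathcal T_{\mathrm{cat}}$ (all sorts acyclic, all maps embeddings). Named quivers: $\emptyset$; $D_2$ (vertices $0,1$, no arrow); $C_2$ (vertices $0,1$, arrows $0,1\colon0\to1$, embeddings $a_0,a_1\colon\mathrm{PQ}_1\to C_2$); $T$ (vertices $0,1,2$, arrows $0\colon0\to1$, $1\colon0\to2$, $2\colon1\to2$; $e_{01},e_{12},e_{02}\colon\mathrm{PQ}_1\to T$ onto arrows $0,2,1$); $\sigma,\tau\colon\mathrm{PQ}_0\to\mathrm{PQ}_1$ onto vertex $0$, resp. $1$; $\mathrm{sp}_{k,l},\mathrm{tp}_{k,l}\colon\mathrm{PQ}_k\to\mathrm{PQ}_l$ with vertex maps $i\mapsto i$, resp. $i\mapsto i+l-k$; $\mathrm{st}_P\colon D_2\to\mathrm{PQ}_k$ ($k\ge1$), $0\mapsto0$, $1\mapsto k$. Pushout configuration: embeddings $m_1\colon Q\to Q_1$, $m_2\colon Q\to Q_2$, $m_1'\colon Q_1\to Q'$, $m_2'\colon Q_2\to Q'$ with $m_1'm_1=m_2'm_2$, $Q'$ covered by the images of $m_1',m_2'$, and image of $m_1'm_1$ = intersection of images of $m_1'$, $m_2'$. $\mathrm{Cospan}_{m_1',m_2'}(x_1,x_2,x')$: $\mathrm{restr}_{m_1'}(x')\approx x_1\wedge\mathrm{restr}_{m_2'}(x')\approx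 x_2$. Axioms: EmptyEU (exactly one element of sort $\emptyset$); RestrComp ($\mathrm{restr}_m\circ\mathrm{restr}_{m'}=\mathrm{restr}_{m'\circ m}$); PushoutEU (for each pushout configuration, $\mathrm{restr}_{m_1}(x_1)\approx\mathrm{restr}_{m_2}(x_2)\to\exists!x'\,\mathrm{Cospan}_{m_1',m_2'}(x_1,x_2,x')$); with $\mathrm{Comp}(x,y,z)$ := $\exists w{:}T\,(\mathrm{restr}_{e_{01}}w\approx x\wedge\mathrm{restr}_{e_{12}}w\approx y\wedge\mathrm{restr}_{e_{02}}w\approx z\wedge\mathrm{commute}(w))$, CompE: $\forall x,y{:}\mathrm{PQ}_1\,(\mathrm{restr}_\tau x\approx\mathrm{restr}_\sigma y\to\exists z\,\mathrm{Comp}(x,y,z))$; $\mathrm{EqPath}_{P_1,P_2}(x_1,x_2)$ for nontrivial path-quivers := $\mathrm{restr}_{\mathrm{st}}(x_1)\approx\mathrm{restr}_{\mathrm{st}}(x_2)\wedge\forall x\,(\mathrm{Cospan}_{m_1',m_2'}(x_1,x_2,x)\to\mathrm{commute}(x))$ for a pushout configuration $(\mathrm{st}_{P_1},\mathrm{st}_{P_2},m_1',m_2')$; $\mathrm{Id}(x,y)$ := $\mathrm{restr}_\sigma y\approx x\wedge\forall z,w\,((\mathrm{Comp}(y,z,w)\to\mathrm{EqPath}(z,w))\wedge(\mathrm{Comp}(z,y,w)\to\mathrm{EqPath}(z,w)))$; IdE: $\forall x\exists y\,\mathrm{Id}(x,y)$; $\mathrm{EqPath}_{\mathrm{PQ}_0,\mathrm{PQ}_0}(x,y)$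 := $x\approx y$, $\mathrm{EqPath}_{\mathrm{PQ}_0,P}(x,y)$ := $\exists z(\mathrm{Id}(x,z)\wedge\mathrm{EqPath}_{\mathrm{PQ}_1,P}(z,y))$, $\mathrm{EqPath}_{P,\mathrm{PQ}_0}(x,y)$ := $\mathrm{EqPath}_{\mathrm{PQ}_0,P}(y,x)$; reflexivity, symmetry, transitivity of EqPath; EqPathConcat: $\mathrm{EqPath}(x_1,x_2)\wedge\mathrm{EqPath}(x_1',x_2')\wedge\mathrm{restr}_{\mathrm{tp}_{0,k_1}}x_1\approx\mathrm{restr}_{\mathrm{sp}_{0,k_1'}}x_1'\to\forall x_1'',x_2''\,(\mathrm{Cospan}_{\mathrm{sp}_{k_1,k_1+k_1'},\mathrm{tp}_{k_1',k_1+k_1'}}(x_1,x_1',x_1'')\wedge\mathrm{Cospan}_{\mathrm{sp}_{k_2,k_2+k_2'},\mathrm{tp}_{k_2',k_2+k_2'}}(x_2,x_2',x_2'')\to\mathrm{EqPath}(x_1'',x_2''))$ (sorts $\mathrm{PQ}_{k_1},\mathrm{PQ}_{k_2},\mathrm{PQ}_{k_1'},\mathrm{PQ}_{k_2'},\mathrm{PQ}_{k_i+k_i'}$); ComEq: $\forall x{:}C_2\,(\mathrm{commute}(x)\to\mathrm{restr}_{a_0}x\approx\mathrm{restr}_{a_1}x)$; PathCom$_Q$: $\forall x{:}Q\,(\bigwedge_{(p_1,p_2)\in\mathcal{BP}_Q}\mathrm{EqPath}(\mathrm{restr}_{p_1}x,\mathrm{restr}_{p_2}x)\leftrightarrow\mathrm{commute}(x))$.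 Theory $\mathcal T_{\mathrm{ab}}$. Mono quiver $M$: vertices $0,1,2$, arrows $g,h\colon0\to1$, $f\colon1\to2$, $k\colon0\to2$. $\mathrm{Mono}(x)$ ($x{:}\mathrm{PQ}_1$) := $\forall y{:}M$: (restriction of $y$ to arrow $f$) $\approx x$ $\wedge$ commute(restriction to the triangle $g,f,k$) $\wedge$ commute(restriction to the triangle $h,f,k$) $\to$ commute(restriction to the subquiver $\{0,1\}$ with arrows $g,h$). $\mathrm{cone}(Q)$: $Q$ plus a new vertex $v_0$ and an arrow $a_v\colon v_0\to v$ for each $v\in V_Q$; $i_Q\colon Q\to\mathrm{cone}(Q)$ the inclusion; for an embedding $m$, $\mathrm{cone}(m)$ extends $m$ by $v_0\mapsto v_0$, $a_v\mapsto a_{m(v)}$; for $a\in A_Q$ also denote $a\colon\mathrm{PQ}_1\to Q$ the embedding onto $a$. $\mathrm{Cone}_Q(x,y)$ := $\mathrm{restr}_{i_Q}(y)\approx x\wedge\bigwedge_{a\in A_Q}\mathrm{commute}(\mathrm{restr}_{\mathrm{cone}(a)}(y))$. $\mathrm{Limit}_Q(x,y)$ := $\mathrm{Cone}_Q(x,y)\wedge\forall z\,(\mathrm{Cone}_Q(x,z)\to\exists!w\,(\mathrm{Cone}_{\mathrm{cone}(Q)}(y,w)\wedge\mathrm{restr}_{\mathrm{cone}(i_Q)}(w)\approx z))$. $\mathrm{Colimit}_Q$ := $(\mathrm{Limit}_{Q^\dagger})^\dagger$. $\mathrm{Zero}(x)$ ($x{:}\mathrm{PQ}_0=\mathrm{cone}(\emptyset)$)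 := $\forall y{:}\emptyset\,(\mathrm{Limit}_\emptyset(y,x)\wedge\mathrm{Colimit}_\emptyset(y,x))$. Let $Q_0$ be the cospan quiver with vertices $a,b,o$ and arrows $f\colon a\to b$, $u\colon o\to b$, and $K=\mathrm{cone}(Q_0)$. $\mathrm{Ker}(x,y)$ ($x,y{:}\mathrm{PQ}_1$) := $\exists z{:}K$: (restriction of $z$ to arrow $f$) $\approx x$ $\wedge$ (restriction to arrow $a_a\colon v_0\to a$) $\approx y$ $\wedge$ Zero(restriction to vertex $o$) $\wedge$ $\mathrm{Limit}_{Q_0}(\mathrm{restr}_{i_{Q_0}}(z),z)$. $\mathcal T_{\mathrm{ab}}$ is $\mathcal T_{\mathrm{cat}}$ together with: ZeroE: $\exists x{:}\mathrm{PQ}_0\,\mathrm{Zero}(x)$; ProductE: $\forall x{:}D_2\,\exists y\,\mathrm{Limit}_{D_2}(x,y)$; CoproductE := ProductE$^\dagger$; KerE: $\forall x\exists y\,\mathrm{Ker}(x,y)$; CokerE := KerE$^\dagger$; MonoNormal: $\forall x\,(\mathrm{Mono}(x)\to\exists y\,\mathrm{Ker}(y,x))$; EpiNormal := MonoNormal$^\dagger$. -}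

module Defs where

open import Level using (0ℓ)
open import Function using (_∘_; id)
open import Data.Bool using (Bool; true; false; if_then_else_; T)
open import Data.Nat using (ℕ; zero; suc; _+_; _*_; _∸_; _<_; _≤_; _≡ᵇ_; _<ᵇ_; _≤ᵇ_; _⊔_; z≤n; s≤s; _<?_; _≟_)
open import Data.Nat.Properties
open import Data.Product using (Σ; _×_; _,_; proj₁; proj₂; ∃; ∃-syntax)
open import Data.Product.Properties using (≡-dec)
open import Data.Sum using (_⊎_; inj₁; inj₂)
open import Data.Unit using (⊤; tt)
open import Data.Empty using (⊥; ⊥-elim)
open import Data.List using (List; []; _∷_; map; length; _++_; foldr; upTo; applyUpTo)
open import Data.List.Properties using (map-∘; map-id; map-cong; length-map; map-upTo; map-applyUpTo)
open import Data.List.Membership.Propositional using (_∈_)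
import Data.List.Membership.DecPropositional as DecMem
open import Data.List.Membership.Propositional.Properties using (∈-map⁺; ∈-map⁻; ∈-upTo⁺; ∈-upTo⁻; ∈-++⁺ˡ; ∈-++⁺ʳ; ∈-++⁻)
open import Data.List.Relation.Unary.Any using (here; there)
open import Data.List.Relation.Unary.All as All using (All; []; _∷_)
import Data.List.Relation.Unary.All.Properties as AllP
open import Data.List.Relation.Unary.Linked as Linked using (Linked; []; [-]; _∷_)
open import Data.List.Relation.Unary.Linked.Properties using (Linked⇒All; applyUpTo⁺₂)
open import Relation.Binary.PropositionalEquality
open import Relation.Nullary using (¬_; Dec; yes; no)
open import Function.Bundles using (_⇔_)
open import Relation.Binary.Definitions using (tri<; tri≈; tri>)
open import Relation.Nullary.Decidable using (True; toWitness; _×-dec_; _→-dec_)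

-- A quiver Q = (V_Q, A_Q, s_Q, t_Q) with V_Q, A_Q finite subsets of ℕ is
-- represented canonically: V_Q is the strictly increasing list of its
-- vertices; A_Q is the list of triples (a , s_Q a , t_Q a), strictly
-- increasing in the arrow name a.  The well-formedness proof is an
-- irrelevant field, so two quivers with the same data are definitionally
-- equal (the representation is canonical).

Arr : Set
Arr = ℕ × ℕ × ℕ

name src tgt : Arr → ℕ
name a = proj₁ a
src a = proj₁ (proj₂ a)
tgt a = proj₂ (proj₂ a)

WFQ : List ℕ → List Arr → Set
WFQ V A = Linked _<_ V × Linked _<_ (map name A) × All (λ a → src a ∈ V × tgt a ∈ V) A

record Quiver : Set where
  constructor mkQ
  field
    V : List ℕ
    A : List Arr
    .wf : WFQ V A
open Quiver public

names : Quiver → List ℕ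
names Q = map name (A Q)

-- A map X → ℕ (X a finite subset, given as a list) is represented
-- canonically by the list of its values, aligned with X.
-- app X ys x = the value at x.
app : List ℕ → List ℕ → ℕ → ℕ
app (x ∷ xs) (y ∷ ys) v = if x ≡ᵇ v then y else app xs ys v
app _ _ _ = 0

IsMorphism : Quiver → Quiver → List ℕ → List ℕ → Set
IsMorphism Q Q' vm am =
  length vm ≡ length (V Q) × length am ≡ length (A Q) ×
  (∀ v → v ∈ V Q → app (V Q) vm v ∈ V Q') ×
  (∀ a s t → (a , s , t) ∈ A Q →
     (app (names Q) am a , app (V Q) vm s , app (V Q) vm t) ∈ A Q')

InjOn : List ℕ → (ℕ → ℕ) → Set
InjOn X f = ∀ x y → x ∈ X → y ∈ X → f x ≡ f y → x ≡ y

IsEmbedding : Quiver → Quiver → List ℕ → List ℕ → Set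
IsEmbedding Q Q' vm am =
  IsMorphism Q Q' vm am × InjOn (V Q) (app (V Q) vm) × InjOn (names Q) (app (names Q) am)

pqArr : ℕ → Arr
pqArr i = (i , i , suc i)

∈pqA : ∀ {k a s t} → (a , s , t) ∈ map pqArr (upTo k) → a < k × s ≡ a × t ≡ suc a
∈pqA {k} p with ∈-map⁻ pqArr p
... | i , i∈ , refl = ∈-upTo⁻ i∈ , refl , refl

names-pq : ∀ k → map name (map pqArr (upTo k)) ≡ upTo k
names-pq k = trans (cong (map name) (map-upTo pqArr k)) (map-applyUpTo pqArr name k)

linked-upTo : ∀ n → Linked _<_ (upTo n)
linked-upTo n = applyUpTo⁺₂ id n (λ i → n<1+n i)

pq-wf : ∀ k → WFQ (upTo (suc k)) (map pqArr (upTo k))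
pq-wf k = linked-upTo (suc k)
        , subst (Linked _<_) (sym (names-pq k)) (linked-upTo k)
        , All.tabulate (λ {x} x∈ → lemma x x∈)
  where
  lemma : ∀ x → x ∈ map pqArr (upTo k) → src x ∈ upTo (suc k) × tgt x ∈ upTo (suc k)
  lemma (a , s , t) x∈ with ∈pqA {k} x∈
  ... | a<k , refl , refl = ∈-upTo⁺ (≤-trans a<k (n≤1+n k)) , ∈-upTo⁺ (s≤s a<k)

PQ : ℕ → Quiver
PQ k = mkQ (upTo (suc k)) (map pqArr (upTo k)) (pq-wf k)

∈namesPQ : ∀ {k x} → x ∈ names (PQ k) → x < k
∈namesPQ {k} p = ∈-upTo⁻ (subst (_ ∈_) (names-pq k) p)

∈namesPQ⁺ : ∀ {k x} → x < k → x ∈ names (PQ k)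
∈namesPQ⁺ {k} p = subst (_ ∈_) (sym (names-pq k)) (∈-upTo⁺ p)

Acyclic : Quiver → Set
Acyclic Q = ∀ k vm am → IsMorphism (PQ k) Q vm am → IsEmbedding (PQ k) Q vm am

linked-lt : ∀ {x xs y} → Linked _<_ (x ∷ xs) → y ∈ xs → x < y
linked-lt [-] ()
linked-lt (x<z ∷ lz) y∈ = All.lookup (Linked⇒All <-trans x<z lz) y∈

key-unique : ∀ (B : List Arr) → Linked _<_ (map name B) → ∀ {a s t s' t'} →
             (a , s , t) ∈ B → (a , s' , t') ∈ B → (s , t) ≡ (s' , t')
key-unique (b ∷ B) l (here refl) (here refl) = refl
key-unique (b ∷ B) l (here refl) (there q) = ⊥-elim (<-irrefl refl (linked-lt l (∈-map⁺ name q)))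
key-unique (b ∷ B) l (there p) (here refl) = ⊥-elim (<-irrefl refl (linked-lt l (∈-map⁺ name p)))
key-unique (b ∷ B) l (there p) (there q) = key-unique B (Linked.tail l) p q

app-map : ∀ X (f : ℕ → ℕ) x → x ∈ X → app X (map f X) x ≡ f x
app-map (y ∷ X) f x x∈ with y ≡ᵇ x in eq
... | true = cong f (≡ᵇ⇒≡ y x (subst T (sym eq) tt))
... | false with x∈
...   | here refl = ⊥-elim (subst T eq (≡⇒≡ᵇ x x refl))
...   | there p = app-map X f x p

rank⇒acyclic : (Q : Quiver) → WFQ (V Q) (A Q) → (r : ℕ → ℕ) →
  (∀ a s t → (a , s , t) ∈ A Q → r s < r t) → Acyclic Q
rank⇒acyclic Q wf r rk k vm am mor = mor , injV , injA
  where
  marr = proj₂ (proj₂ (proj₂ mor))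
  f = app (upTo (suc k)) vm
  g = app (names (PQ k)) am
  memA : ∀ i → i < k → (g i , f i , f (suc i)) ∈ A Q
  memA i i<k = marr i i (suc i) (∈-map⁺ pqArr (∈-upTo⁺ i<k))
  step : ∀ i → i < k → r (f i) < r (f (suc i))
  step i i<k = rk _ _ _ (memA i i<k)
  mono : ∀ i j → i < j → j ≤ k → r (f i) < r (f j)
  mono i (suc j) (s≤s i≤j) sj≤k with m≤n⇒m<n∨m≡n i≤j
  ... | inj₁ i<j = <-trans (mono i j i<j (≤-trans (n≤1+n j) sj≤k)) (step j sj≤k)
  ... | inj₂ refl = step i sj≤k
  injV : InjOn (upTo (suc k)) f
  injV x y x∈ y∈ fx≡fy with <-cmp x y
  ... | tri< x<y _ _ = ⊥-elim (<-irrefl (cong r fx≡fy) (mono x y x<y (≤-pred (∈-upTo⁻ y∈))))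
  ... | tri≈ _ x≡y _ = x≡y
  ... | tri> _ _ y<x = ⊥-elim (<-irrefl (cong r (sym fx≡fy)) (mono y x y<x (≤-pred (∈-upTo⁻ x∈))))
  injA : InjOn (names (PQ k)) g
  injA x y x∈ y∈ gx≡gy =
    injV x y (∈-upTo⁺ (≤-trans (∈namesPQ x∈) (n≤1+n k))) (∈-upTo⁺ (≤-trans (∈namesPQ y∈) (n≤1+n k)))
      (cong proj₁ (key-unique (A Q) (proj₁ (proj₂ wf))
        (subst (λ z → (z , f x , f (suc x)) ∈ A Q) gx≡gy (memA x (∈namesPQ x∈)))
        (memA y (∈namesPQ y∈))))

acyclic-PQ : ∀ k → Acyclic (PQ k)
acyclic-PQ k = rank⇒acyclic (PQ k) (pq-wf k) id (λ a s t p → lemma (∈pqA {k} p))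
  where
  lemma : ∀ {a s t} → a < k × s ≡ a × t ≡ suc a → s < t
  lemma (_ , refl , refl) = n<1+n _

-- The sorts of Σ: acyclic quivers.  Embeddings m : Q' → Q between them.
-- (Proofs are irrelevant fields, so the data alone determine the object.)

record Sort : Set where
  constructor mkS
  field
    quiver : Quiver
    .acyclic : Acyclic quiver
open Sort public

record Emb (Q' Q : Sort) : Set where
  constructor mkE
  field
    vm : List ℕ
    am : List ℕ
    .isEmb : IsEmbedding (quiver Q') (quiver Q) vm am
open Emb public

mapV : ∀ {Q' Q} → Emb Q' Q → ℕ → ℕ
mapV {Q'} e = app (V (quiver Q')) (vm e)

mapA : ∀ {Q' Q} → Emb Q' Q → ℕ → ℕ
mapA {Q'} e = app (names (quiver Q')) (am e)

PQS : ℕ → Sort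
PQS k = mkS (PQ k) (acyclic-PQ k)

swapA : Arr → Arr
swapA a = (name a , tgt a , src a)

names-swap : ∀ B → map name (map swapA B) ≡ map name B
names-swap B = sym (map-∘ B)

wf† : ∀ V B → WFQ V B → WFQ V (map swapA B)
wf† V B (l1 , l2 , al) =
  l1 , subst (Linked _<_) (sym (names-swap B)) l2 ,
  AllP.map⁺ (All.map (λ pq → proj₂ pq , proj₁ pq) al)

_†Q : Quiver → Quiver
mkQ V B w †Q = mkQ V (map swapA B) (wf† V B w)

∈swap⁺ : ∀ {B a s t} → (a , s , t) ∈ B → (a , t , s) ∈ map swapA B
∈swap⁺ p = ∈-map⁺ swapA p

∈swap⁻ : ∀ {B a s t} → (a , s , t) ∈ map swapA B → (a , t , s) ∈ B
∈swap⁻ p with ∈-map⁻ swapA p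
... | (b1 , b2 , b3) , b∈ , refl = b∈

private
  L1 : ∀ {a k} → a < k → suc (k ∸ suc a) ≡ k ∸ a
  L1 a<k = sym (+-∸-assoc 1 a<k)

  L3 : ∀ {x k} → x < k → k ∸ suc (k ∸ suc x) ≡ x
  L3 {x} {k} x<k = trans (cong (k ∸_) (L1 x<k)) (m∸[m∸n]≡n (<⇒≤ x<k))

  Llt : ∀ {x k} → x < k → k ∸ suc x < k
  Llt {x} {suc k} _ = s≤s (m∸n≤m k x)

acyclic† : (Q : Quiver) → Acyclic Q → Acyclic (Q †Q)
acyclic† (mkQ VQ AQ w) ac k vm am mor = mor , injV , injA
  where
  VP = upTo (suc k)
  NP = names (PQ k)
  f = app VP vm
  g = app NP am
  vm' = map (λ i → f (k ∸ i)) VP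
  am' = map (λ i → g (k ∸ suc i)) NP
  mV = proj₁ (proj₂ (proj₂ mor))
  marr = proj₂ (proj₂ (proj₂ mor))
  vert : ∀ v → v ∈ VP → app VP vm' v ∈ VQ
  vert v v∈ = subst (_∈ VQ) (sym (app-map VP _ v v∈)) (mV (k ∸ v) (∈-upTo⁺ (s≤s (m∸n≤m k v))))
  arrow : ∀ a → a < k → (g (k ∸ suc a) , f (k ∸ a) , f (k ∸ suc a)) ∈ AQ
  arrow a a<k = subst (λ z → (g (k ∸ suc a) , f z , f (k ∸ suc a)) ∈ AQ) (L1 a<k)
    (∈swap⁻ (marr (k ∸ suc a) (k ∸ suc a) (suc (k ∸ suc a)) (∈-map⁺ pqArr (∈-upTo⁺ (Llt a<k)))))
  arr : ∀ a s t → (a , s , t) ∈ A (PQ k) →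
        (app NP am' a , app VP vm' s , app VP vm' t) ∈ AQ
  arr a s t p with ∈pqA {k} p
  ... | a<k , refl , refl
    rewrite app-map NP (λ i → g (k ∸ suc i)) a (∈namesPQ⁺ a<k)
          | app-map VP (λ i → f (k ∸ i)) a (∈-upTo⁺ (≤-trans a<k (n≤1+n k)))
          | app-map VP (λ i → f (k ∸ i)) (suc a) (∈-upTo⁺ (s≤s a<k)) = arrow a a<k
  mor' : IsMorphism (PQ k) (mkQ VQ AQ w) vm' am'
  mor' = length-map _ VP , trans (length-map _ NP) (length-map name (A (PQ k))) , vert , arr
  emb' = ac k vm' am' mor'
  injV : InjOn VP f
  injV x y x∈ y∈ fxy =
    ∸-cancelˡ-≡ x≤k y≤k
      (proj₁ (proj₂ emb') (k ∸ x) (k ∸ y) (∈-upTo⁺ (s≤s (m∸n≤m k x))) (∈-upTo⁺ (s≤s (m∸n≤m k y)))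
        (trans (app-map VP _ (k ∸ x) (∈-upTo⁺ (s≤s (m∸n≤m k x))))
        (trans (cong f (m∸[m∸n]≡n x≤k))
        (trans fxy
        (sym (trans (app-map VP _ (k ∸ y) (∈-upTo⁺ (s≤s (m∸n≤m k y)))) (cong f (m∸[m∸n]≡n y≤k))))))))
    where
    x≤k = ≤-pred (∈-upTo⁻ x∈)
    y≤k = ≤-pred (∈-upTo⁻ y∈)
  injA : InjOn NP g
  injA x y x∈ y∈ gxy =
    suc-injective (∸-cancelˡ-≡ x<k y<k
      (proj₂ (proj₂ emb') (k ∸ suc x) (k ∸ suc y) (∈namesPQ⁺ (Llt x<k)) (∈namesPQ⁺ (Llt y<k))
        (trans (app-map NP _ (k ∸ suc x) (∈namesPQ⁺ (Llt x<k)))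
        (trans (cong g (L3 x<k))
        (trans gxy
        (sym (trans (app-map NP _ (k ∸ suc y) (∈namesPQ⁺ (Llt y<k))) (cong g (L3 y<k)))))))))
    where
    x<k = ∈namesPQ x∈
    y<k = ∈namesPQ y∈

emb† : ∀ (Q' Q : Quiver) vm am → IsEmbedding Q' Q vm am → IsEmbedding (Q' †Q) (Q †Q) vm am
emb† (mkQ V' A' w') (mkQ VQ AQ w) vm am ((l1 , l2 , mV , marr) , injV , injA) =
  (l1 , trans l2 (sym (length-map swapA A')) , mV , arr) , injV ,
  subst (λ N → InjOn N (app N am)) (sym (names-swap A')) injA
  where
  arr : ∀ a s t → (a , s , t) ∈ map swapA A' →
        (app (map name (map swapA A')) am a , app V' vm s , app V' vm t) ∈ map swapA AQ
  arr a s t p = subst (λ N → (app N am a , app V' vm s , app V' vm t) ∈ map swapA AQ)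
                  (sym (names-swap A')) (∈swap⁺ (marr a t s (∈swap⁻ p)))

_†S : Sort → Sort
mkS Q ac †S = mkS (Q †Q) (acyclic† Q ac)

_†E : ∀ {Q' Q} → Emb Q' Q → Emb (Q' †S) (Q †S)
_†E {mkS Q' _} {mkS Q _} (mkE vm am e) = mkE vm am (emb† Q' Q vm am e)

-- Decision procedures, used only to produce the irrelevant proofs that
-- the concrete quivers below are acyclic and that the concrete maps
-- below are embeddings.

arr≟ : (x y : Arr) → Dec (x ≡ y)
arr≟ = ≡-dec _≟_ (≡-dec _≟_ _≟_)

_∈ℕ?_ : (x : ℕ) (xs : List ℕ) → Dec (x ∈ xs)
_∈ℕ?_ = DecMem._∈?_ _≟_

_∈A?_ : (x : Arr) (xs : List Arr) → Dec (x ∈ xs)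
_∈A?_ = DecMem._∈?_ arr≟

wf? : ∀ VV B → Dec (WFQ VV B)
wf? VV B = Linked.linked? _<?_ VV ×-dec Linked.linked? _<?_ (map name B) ×-dec
           All.all? (λ a → (src a ∈ℕ? VV) ×-dec (tgt a ∈ℕ? VV)) B

rank? : ∀ B (r : ℕ → ℕ) → Dec (All (λ a → r (src a) < r (tgt a)) B)
rank? B r = All.all? (λ a → r (src a) <? r (tgt a)) B

mkSortR : (VV : List ℕ) (B : List Arr) (r : ℕ → ℕ) →
          {w : True (wf? VV B)} → {rk : True (rank? B r)} → Sort
mkSortR VV B r {w} {rk} =
  mkS (mkQ VV B (toWitness w))
      (rank⇒acyclic (mkQ VV B (toWitness w)) (toWitness w) r (λ a s t p → All.lookup (toWitness rk) p))

EmbCheck : Quiver → Quiver → List ℕ → List ℕ → Set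
EmbCheck Q' Q vm am =
  length vm ≡ length (V Q') × length am ≡ length (A Q') ×
  All (λ v → app (V Q') vm v ∈ V Q) (V Q') ×
  All (λ a → (app (names Q') am (name a) , app (V Q') vm (src a) , app (V Q') vm (tgt a)) ∈ A Q) (A Q') ×
  All (λ x → All (λ y → app (V Q') vm x ≡ app (V Q') vm y → x ≡ y) (V Q')) (V Q') ×
  All (λ x → All (λ y → app (names Q') am x ≡ app (names Q') am y → x ≡ y) (names Q')) (names Q')

embCheck? : ∀ Q' Q vm am → Dec (EmbCheck Q' Q vm am)
embCheck? Q' Q vm am =
  (length vm ≟ length (V Q')) ×-dec (length am ≟ length (A Q')) ×-dec
  All.all? (λ v → app (V Q') vm v ∈ℕ? V Q) (V Q') ×-dec
  All.all? (λ a → (app (names Q') am (name a) , app (V Q') vm (src a) , app (V Q') vm (tgt a)) ∈A? A Q) (A Q') ×-dec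
  All.all? (λ x → All.all? (λ y → (app (V Q') vm x ≟ app (V Q') vm y) →-dec (x ≟ y)) (V Q')) (V Q') ×-dec
  All.all? (λ x → All.all? (λ y → (app (names Q') am x ≟ app (names Q') am y) →-dec (x ≟ y)) (names Q')) (names Q')

embCheck⇒ : ∀ Q' Q vm am → EmbCheck Q' Q vm am → IsEmbedding Q' Q vm am
embCheck⇒ Q' Q vm am (l1 , l2 , av , aa , iv , ia) =
  (l1 , l2 , (λ v p → All.lookup av p) , (λ a s t p → All.lookup aa p)) ,
  (λ x y px py e → All.lookup (All.lookup iv px) py e) ,
  (λ x y px py e → All.lookup (All.lookup ia px) py e)

mkEmbD : (Q' Q : Sort) (vm am : List ℕ) →
         {ok : True (embCheck? (quiver Q') (quiver Q) vm am)} → Emb Q' Q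
mkEmbD Q' Q vm am {ok} = mkE vm am (embCheck⇒ (quiver Q') (quiver Q) vm am (toWitness ok))

∅S : Sort
∅S = mkSortR [] [] id

D₂ : Sort
D₂ = mkSortR (0 ∷ 1 ∷ []) [] id

C₂ : Sort
C₂ = mkSortR (0 ∷ 1 ∷ []) ((0 , 0 , 1) ∷ (1 , 0 , 1) ∷ []) id

TS : Sort
TS = mkSortR (0 ∷ 1 ∷ 2 ∷ []) ((0 , 0 , 1) ∷ (1 , 0 , 2) ∷ (2 , 1 , 2) ∷ []) id

-- mono quiver M : arrows g = 0, h = 1 : 0 → 1, f = 2 : 1 → 2, k = 3 : 0 → 2
MS : Sort
MS = mkSortR (0 ∷ 1 ∷ 2 ∷ []) ((0 , 0 , 1) ∷ (1 , 0 , 1) ∷ (2 , 1 , 2) ∷ (3 , 0 , 2) ∷ []) id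

-- cospan quiver Q₀ : vertices a = 0, b = 1, o = 2; arrows f = 0 : a → b, u = 1 : o → b
rQ₀ : ℕ → ℕ
rQ₀ v = if v ≡ᵇ 1 then 1 else 0

Q₀S : Sort
Q₀S = mkSortR (0 ∷ 1 ∷ 2 ∷ []) ((0 , 0 , 1) ∷ (1 , 2 , 1) ∷ []) rQ₀

σE τE : Emb (PQS 0) (PQS 1)
σE = mkEmbD (PQS 0) (PQS 1) (0 ∷ []) []
τE = mkEmbD (PQS 0) (PQS 1) (1 ∷ []) []

e₀₁ e₁₂ e₀₂ : Emb (PQS 1) TS
e₀₁ = mkEmbD (PQS 1) TS (0 ∷ 1 ∷ []) (0 ∷ [])
e₁₂ = mkEmbD (PQS 1) TS (1 ∷ 2 ∷ []) (2 ∷ [])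
e₀₂ = mkEmbD (PQS 1) TS (0 ∷ 2 ∷ []) (1 ∷ [])

a₀E a₁E : Emb (PQS 1) C₂
a₀E = mkEmbD (PQS 1) C₂ (0 ∷ 1 ∷ []) (0 ∷ [])
a₁E = mkEmbD (PQS 1) C₂ (0 ∷ 1 ∷ []) (1 ∷ [])

test∅ : ∅S †S ≡ ∅S
test∅ = refl

app-self : ∀ X x → x ∈ X → app X X x ≡ x
app-self X x p = subst (λ Y → app X Y x ≡ x) (map-id X) (app-map X id x p)

shift-emb : ∀ k l d → k + d ≤ l →
  IsEmbedding (PQ k) (PQ l) (map (_+ d) (V (PQ k))) (map (_+ d) (names (PQ k)))
shift-emb k l d le =
  (length-map _ VP , trans (length-map _ NP) (length-map name (A (PQ k))) , vert , arr) ,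
  (λ x y px py e → +-cancelʳ-≡ d x y (trans (sym (app-map VP (_+ d) x px)) (trans e (app-map VP (_+ d) y py)))) ,
  (λ x y px py e → +-cancelʳ-≡ d x y (trans (sym (app-map NP (_+ d) x px)) (trans e (app-map NP (_+ d) y py))))
  where
  VP = V (PQ k)
  NP = names (PQ k)
  vert : ∀ v → v ∈ VP → app VP (map (_+ d) VP) v ∈ V (PQ l)
  vert v p rewrite app-map VP (_+ d) v p =
    ∈-upTo⁺ (s≤s (≤-trans (+-monoˡ-≤ d (≤-pred (∈-upTo⁻ p))) le))
  arr : ∀ a s t → (a , s , t) ∈ A (PQ k) →
        (app NP (map (_+ d) NP) a , app VP (map (_+ d) VP) s , app VP (map (_+ d) VP) t) ∈ A (PQ l)
  arr a s t p with ∈pqA {k} p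
  ... | a<k , refl , refl
    rewrite app-map NP (_+ d) a (∈namesPQ⁺ a<k)
          | app-map VP (_+ d) a (∈-upTo⁺ (≤-trans a<k (n≤1+n k)))
          | app-map VP (_+ d) (suc a) (∈-upTo⁺ (s≤s a<k)) =
    ∈-map⁺ pqArr (∈-upTo⁺ (≤-trans (+-monoˡ-≤ d a<k) le))

shiftE : ∀ k l d → .(k + d ≤ l) → Emb (PQS k) (PQS l)
shiftE k l d le = mkE (map (_+ d) (V (PQ k))) (map (_+ d) (names (PQ k))) (shift-emb k l d le)

spE : ∀ k l → .(k ≤ l) → Emb (PQS k) (PQS l)
spE k l le = shiftE k l 0 (subst (_≤ l) (sym (+-identityʳ k)) le)

tpE : ∀ k l → .(k ≤ l) → Emb (PQS k) (PQS l)
tpE k l le = shiftE k l (l ∸ k) (≤-reflexive (m+[n∸m]≡n le))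

st-emb : ∀ n → IsEmbedding (quiver D₂) (PQ (suc n)) (0 ∷ suc n ∷ []) []
st-emb n = (refl , refl , vert , (λ { a s t () })) , injV , (λ { x y () })
  where
  vert : ∀ v → v ∈ 0 ∷ 1 ∷ [] → app (0 ∷ 1 ∷ []) (0 ∷ suc n ∷ []) v ∈ upTo (suc (suc n))
  vert .0 (here refl) = ∈-upTo⁺ (s≤s z≤n)
  vert .1 (there (here refl)) = ∈-upTo⁺ (n<1+n (suc n))
  injV : InjOn (0 ∷ 1 ∷ []) (app (0 ∷ 1 ∷ []) (0 ∷ suc n ∷ []))
  injV .0 .0 (here refl) (here refl) e = refl
  injV .0 .1 (here refl) (there (here refl)) ()
  injV .1 .0 (there (here refl)) (here refl) ()
  injV .1 .1 (there (here refl)) (there (here refl)) e = refl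

stE : ∀ n → Emb D₂ (PQS (suc n))
stE n = mkE (0 ∷ suc n ∷ []) [] (st-emb n)

-- The pushout configuration (st_{P₁}, st_{P₂}, m₁', m₂') used in EqPath:
-- for P₁ = PQ_{k₁}, P₂ = PQ_{k₂} (k₁ = suc n₁, k₂ = suc n₂) the quiver B
-- ("bigon") has vertices 0 … k₁ + n₂; the first path is 0 → 1 → … → k₁
-- (arrows 0 … k₁−1), the second path is 0 → k₁+1 → … → k₁+n₂ → k₁
-- (arrows k₁ … k₁+k₂−1).  m₁' is the inclusion of the first path, m₂'
-- that of the second; they agree on the two end-points (the image of D₂)
-- and their images cover B and intersect exactly in the image of D₂.

private
  lt-true : ∀ {m n} → m < n → (m <ᵇ n) ≡ true
  lt-true {m} {n} p with m <ᵇ n | <⇒<ᵇ p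
  ... | true | _ = refl

  lt-false : ∀ {m n} → n ≤ m → (m <ᵇ n) ≡ false
  lt-false {m} {n} p with m <ᵇ n | <ᵇ⇒< m n
  ... | false | _ = refl
  ... | true | f = ⊥-elim (<⇒≱ (f tt) p)

  le-true : ∀ {m n} → m ≤ n → (m ≤ᵇ n) ≡ true
  le-true {m} {n} p with m ≤ᵇ n | ≤⇒≤ᵇ p
  ... | true | _ = refl

  le-false : ∀ {m n} → n < m → (m ≤ᵇ n) ≡ false
  le-false {m} {n} p with m ≤ᵇ n | ≤ᵇ⇒≤ m n
  ... | false | _ = refl
  ... | true | f = ⊥-elim (<⇒≱ p (f tt))

  eqb-refl : ∀ m → (m ≡ᵇ m) ≡ true
  eqb-refl zero = refl
  eqb-refl (suc m) = eqb-refl m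

  eqb-false : ∀ {m n} → m ≢ n → (m ≡ᵇ n) ≡ false
  eqb-false {m} {n} p with m ≡ᵇ n | ≡ᵇ⇒≡ m n
  ... | false | _ = refl
  ... | true | f = ⊥-elim (p (f tt))

module Bigon (n₁ n₂ : ℕ) where
  k₁ k₂ : ℕ
  k₁ = suc n₁
  k₂ = suc n₂

  v₂ : ℕ → ℕ
  v₂ zero = 0
  v₂ (suc j) = if suc j ≡ᵇ k₂ then k₁ else k₁ + suc j

  bArr : ℕ → Arr
  bArr a = if a <ᵇ k₁ then (a , a , suc a) else (a , v₂ (a ∸ k₁) , v₂ (suc (a ∸ k₁)))

  BV : List ℕ
  BV = upTo (suc (k₁ + n₂))

  BA : List Arr
  BA = map bArr (upTo (k₁ + k₂))

  private
    bArr-lo : ∀ {b} → b < k₁ → bArr b ≡ (b , b , suc b)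
    bArr-lo {b} p rewrite lt-true p = refl

    bArr-hi : ∀ {b} → k₁ ≤ b → bArr b ≡ (b , v₂ (b ∸ k₁) , v₂ (suc (b ∸ k₁)))
    bArr-hi {b} p rewrite lt-false p = refl

    name-bArr : ∀ b → name (bArr b) ≡ b
    name-bArr b with b <ᵇ k₁
    ... | true = refl
    ... | false = refl

    v₂-end : v₂ k₂ ≡ k₁
    v₂-end rewrite eqb-refl n₂ = refl

    v₂-mid : ∀ j → suc j < k₂ → v₂ (suc j) ≡ k₁ + suc j
    v₂-mid j p rewrite eqb-false {suc j} {k₂} (λ e → <-irrefl e p) = refl

    v₂-cases : ∀ j → suc j ≤ k₂ → (suc j < k₂ × v₂ (suc j) ≡ k₁ + suc j) ⊎ (suc j ≡ k₂ × v₂ (suc j) ≡ k₁)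
    v₂-cases j p with m≤n⇒m<n∨m≡n p
    ... | inj₁ q = inj₁ (q , v₂-mid j q)
    ... | inj₂ refl = inj₂ (refl , v₂-end)

    v₂∈ : ∀ j → j ≤ k₂ → v₂ j ∈ BV
    v₂∈ zero _ = ∈-upTo⁺ (s≤s z≤n)
    v₂∈ (suc j) p with v₂-cases j p
    ... | inj₁ (q , e) rewrite e = ∈-upTo⁺ (s≤s (+-monoʳ-≤ k₁ (≤-pred q)))
    ... | inj₂ (_ , e) rewrite e = ∈-upTo⁺ (s≤s (m≤m+n k₁ n₂))

    ≤k₁∈ : ∀ {v} → v ≤ k₁ → v ∈ BV
    ≤k₁∈ p = ∈-upTo⁺ (s≤s (≤-trans p (m≤m+n k₁ n₂)))

    names-B : map name BA ≡ upTo (k₁ + k₂)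
    names-B = trans (sym (map-∘ (upTo (k₁ + k₂)))) (trans (map-cong name-bArr (upTo (k₁ + k₂))) (map-id _))

    hi-split : ∀ {b} → k₁ ≤ b → b < k₁ + k₂ → b ∸ k₁ < k₂
    hi-split {b} p q = +-cancelˡ-< k₁ (b ∸ k₁) k₂ (subst (_< k₁ + k₂) (sym (m+[n∸m]≡n p)) q)

    ends : ∀ b → b < k₁ + k₂ → src (bArr b) ∈ BV × tgt (bArr b) ∈ BV
    ends b q with <-cmp b k₁
    ... | tri< p _ _ rewrite bArr-lo p = ≤k₁∈ (<⇒≤ p) , ≤k₁∈ p
    ... | tri≈ _ p _ rewrite bArr-hi (≤-reflexive (sym p)) =
      v₂∈ _ (<⇒≤ (hi-split (≤-reflexive (sym p)) q)) , v₂∈ _ (hi-split (≤-reflexive (sym p)) q)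
    ... | tri> _ _ p rewrite bArr-hi (<⇒≤ p) = v₂∈ _ (<⇒≤ (hi-split (<⇒≤ p) q)) , v₂∈ _ (hi-split (<⇒≤ p) q)

  B-wf : WFQ BV BA
  B-wf = linked-upTo _ , subst (Linked _<_) (sym names-B) (linked-upTo _) ,
         AllP.map⁺ (All.tabulate (λ {b} p → ends b (∈-upTo⁻ p)))

  rB : ℕ → ℕ
  rB v = if v ≤ᵇ k₁ then v * k₂ else (v ∸ k₁) * k₁

  private
    rB-lo : ∀ {v} → v ≤ k₁ → rB v ≡ v * k₂
    rB-lo p rewrite le-true p = refl

    rB-hi : ∀ {v} → k₁ < v → rB v ≡ (v ∸ k₁) * k₁
    rB-hi p rewrite le-false p = refl

    rv₂ : ∀ j → j ≤ k₂ → rB (v₂ j) ≡ j * k₁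
    rv₂ zero _ = refl
    rv₂ (suc j) p with v₂-cases j p
    ... | inj₁ (_ , e) rewrite e =
      trans (rB-hi (m<m+n k₁ (s≤s z≤n))) (cong (_* k₁) (m+n∸m≡n k₁ (suc j)))
    ... | inj₂ (q , e) rewrite e =
      trans (rB-lo ≤-refl) (trans (*-comm k₁ k₂) (cong (_* k₁) (sym q)))

    rank-bArr : ∀ b → b < k₁ + k₂ → rB (src (bArr b)) < rB (tgt (bArr b))
    rank-bArr b q with <-cmp b k₁
    ... | tri< p _ _ rewrite bArr-lo p | rB-lo (<⇒≤ p) | rB-lo p = m<n+m (b * k₂) (s≤s z≤n)
    ... | tri≈ _ p _ rewrite bArr-hi (≤-reflexive (sym p))
                           | rv₂ _ (<⇒≤ (hi-split (≤-reflexive (sym p)) q))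
                           | rv₂ _ (hi-split (≤-reflexive (sym p)) q) = m<n+m _ (s≤s z≤n)
    ... | tri> _ _ p rewrite bArr-hi (<⇒≤ p)
                           | rv₂ _ (<⇒≤ (hi-split (<⇒≤ p) q))
                           | rv₂ _ (hi-split (<⇒≤ p) q) = m<n+m _ (s≤s z≤n)

  B-rank : ∀ a s t → (a , s , t) ∈ BA → rB s < rB t
  B-rank a s t p with ∈-map⁻ bArr p
  ... | b , b∈ , e = subst₂ (λ x y → rB x < rB y) (sym (cong src e)) (sym (cong tgt e)) (rank-bArr b (∈-upTo⁻ b∈))

  BQ : Quiver
  BQ = mkQ BV BA B-wf

  BS : Sort
  BS = mkS BQ (rank⇒acyclic BQ B-wf rB B-rank)

  private
    P₁ P₂ : Quiver
    P₁ = PQ k₁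
    P₂ = PQ k₂

    m₁-emb : IsEmbedding P₁ BQ (V P₁) (names P₁)
    m₁-emb = (refl , length-map name (A P₁) , vert , arr) ,
             (λ x y px py e → trans (sym (app-self (V P₁) x px)) (trans e (app-self (V P₁) y py))) ,
             (λ x y px py e → trans (sym (app-self (names P₁) x px)) (trans e (app-self (names P₁) y py)))
      where
      vert : ∀ v → v ∈ V P₁ → app (V P₁) (V P₁) v ∈ BV
      vert v p rewrite app-self (V P₁) v p = ≤k₁∈ (≤-pred (∈-upTo⁻ p))
      arr : ∀ a s t → (a , s , t) ∈ A P₁ →
            (app (names P₁) (names P₁) a , app (V P₁) (V P₁) s , app (V P₁) (V P₁) t) ∈ BA
      arr a s t p with ∈pqA {k₁} p
      ... | a<k , refl , refl
        rewrite app-self (names P₁) a (∈namesPQ⁺ a<k)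
              | app-self (V P₁) a (∈-upTo⁺ (≤-trans a<k (n≤1+n k₁)))
              | app-self (V P₁) (suc a) (∈-upTo⁺ (s≤s a<k)) =
        subst (_∈ BA) (bArr-lo a<k) (∈-map⁺ bArr (∈-upTo⁺ (≤-trans a<k (m≤m+n k₁ k₂))))

    m₂-emb : IsEmbedding P₂ BQ (map v₂ (V P₂)) (map (k₁ +_) (names P₂))
    m₂-emb = (length-map v₂ (V P₂) , trans (length-map _ (names P₂)) (length-map name (A P₂)) , vert , arr) ,
             injV ,
             (λ x y px py e → +-cancelˡ-≡ k₁ x y
                (trans (sym (app-map (names P₂) (k₁ +_) x px)) (trans e (app-map (names P₂) (k₁ +_) y py))))
      where
      vert : ∀ v → v ∈ V P₂ → app (V P₂) (map v₂ (V P₂)) v ∈ BV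
      vert v p rewrite app-map (V P₂) v₂ v p = v₂∈ v (≤-pred (∈-upTo⁻ p))
      arr : ∀ a s t → (a , s , t) ∈ A P₂ →
            (app (names P₂) (map (k₁ +_) (names P₂)) a , app (V P₂) (map v₂ (V P₂)) s ,
             app (V P₂) (map v₂ (V P₂)) t) ∈ BA
      arr a s t p with ∈pqA {k₂} p
      ... | a<k , refl , refl
        rewrite app-map (names P₂) (k₁ +_) a (∈namesPQ⁺ a<k)
              | app-map (V P₂) v₂ a (∈-upTo⁺ (≤-trans a<k (n≤1+n k₂)))
              | app-map (V P₂) v₂ (suc a) (∈-upTo⁺ (s≤s a<k)) =
        subst (_∈ BA) (trans (bArr-hi (m≤m+n k₁ a)) (cong (λ z → (k₁ + a , v₂ z , v₂ (suc z))) (m+n∸m≡n k₁ a)))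
          (∈-map⁺ bArr (∈-upTo⁺ (+-monoʳ-< k₁ a<k)))
      injV : InjOn (V P₂) (app (V P₂) (map v₂ (V P₂)))
      injV x y px py e =
        *-cancelʳ-≡ x y k₁
          (trans (sym (rv₂ x (≤-pred (∈-upTo⁻ px))))
          (trans (cong rB (trans (sym (app-map (V P₂) v₂ x px)) (trans e (app-map (V P₂) v₂ y py))))
                 (rv₂ y (≤-pred (∈-upTo⁻ py)))))

  m₁'E : Emb (PQS k₁) BS
  m₁'E = mkE (V P₁) (names P₁) m₁-emb

  m₂'E : Emb (PQS k₂) BS
  m₂'E = mkE (map v₂ (V P₂)) (map (k₁ +_) (names P₂)) m₂-emb

-- Cones.  cone(Q) = Q plus a new vertex v₀ (= 1 + max V_Q, or 0 if Q has
-- no vertex) and arrows a_v : v₀ → v named base + v, where base = 1 + the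
-- largest arrow name of Q (or 0).  (So cone(∅) = PQ₀.)

coneV0 : List ℕ → ℕ
coneV0 = foldr (λ v m → suc v ⊔ m) 0

coneBase : List Arr → ℕ
coneBase = foldr (λ a m → suc (name a) ⊔ m) 0

coneVs : Quiver → List ℕ
coneVs Q = V Q ++ (coneV0 (V Q) ∷ [])

coneAs : Quiver → List Arr
coneAs Q = A Q ++ map (λ v → (coneBase (A Q) + v , coneV0 (V Q) , v)) (V Q)

coneRank : Quiver → (ℕ → ℕ) → ℕ → ℕ
coneRank Q r v = if v ≡ᵇ coneV0 (V Q) then 0 else suc (r v)

coneS : (Q : Sort) (r : ℕ → ℕ) →
        {w : True (wf? (coneVs (quiver Q)) (coneAs (quiver Q)))} →
        {rk : True (rank? (coneAs (quiver Q)) (coneRank (quiver Q) r))} → Sort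
coneS Q r {w} {rk} = mkSortR (coneVs (quiver Q)) (coneAs (quiver Q)) (coneRank (quiver Q) r) {w} {rk}

-- cone(m) for a map m : Q → Q' with vertex/arrow lists vm, am:
-- extends m by v₀ ↦ v₀, a_v ↦ a_{m(v)}
coneVm : (Q Q' : Quiver) → List ℕ → List ℕ
coneVm Q Q' vm = vm ++ (coneV0 (V Q') ∷ [])

coneAm : (Q Q' : Quiver) → List ℕ → List ℕ → List ℕ
coneAm Q Q' vm am = am ++ map (λ v → coneBase (A Q') + app (V Q) vm v) (V Q)

iE : (Q CQ : Sort) → {ok : True (embCheck? (quiver Q) (quiver CQ) (V (quiver Q)) (names (quiver Q)))} → Emb Q CQ
iE Q CQ {ok} = mkEmbD Q CQ (V (quiver Q)) (names (quiver Q)) {ok}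

coneE : ∀ {Q Q'} (m : Emb Q Q') (CQ CQ' : Sort) →
        {ok : True (embCheck? (quiver CQ) (quiver CQ')
                     (coneVm (quiver Q) (quiver Q') (vm m)) (coneAm (quiver Q) (quiver Q') (vm m) (am m)))} →
        Emb CQ CQ'
coneE {Q} {Q'} m CQ CQ' {ok} =
  mkEmbD CQ CQ' (coneVm (quiver Q) (quiver Q') (vm m)) (coneAm (quiver Q) (quiver Q') (vm m) (am m)) {ok}

conePQ₁ : Sort
conePQ₁ = coneS (PQS 1) id

-- for an arrow a of Q, the embedding a : PQ₁ → Q is given by
-- (src a ∷ tgt a ∷ [] , name a ∷ []); cone(a) : cone(PQ₁) → cone(Q)
arrVm : Arr → List ℕ
arrVm a = src a ∷ tgt a ∷ []

arrAm : Arr → List ℕ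
arrAm a = name a ∷ []

ConeArrOK : Sort → Sort → Arr → Set
ConeArrOK Q CQ a = EmbCheck (quiver conePQ₁) (quiver CQ)
  (coneVm (PQ 1) (quiver Q) (arrVm a)) (coneAm (PQ 1) (quiver Q) (arrVm a) (arrAm a))

coneArrOK? : ∀ Q CQ a → Dec (ConeArrOK Q CQ a)
coneArrOK? Q CQ a = embCheck? (quiver conePQ₁) (quiver CQ)
  (coneVm (PQ 1) (quiver Q) (arrVm a)) (coneAm (PQ 1) (quiver Q) (arrVm a) (arrAm a))

coneArrs : (Q CQ : Sort) → {ok : True (All.all? (coneArrOK? Q CQ) (A (quiver Q)))} → List (Emb conePQ₁ CQ)
coneArrs Q CQ {ok} = build (A (quiver Q)) (toWitness ok)
  where
  build : (B : List Arr) → All (ConeArrOK Q CQ) B → List (Emb conePQ₁ CQ)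
  build [] [] = []
  build (a ∷ B) (p ∷ ps) =
    mkE (coneVm (PQ 1) (quiver Q) (arrVm a)) (coneAm (PQ 1) (quiver Q) (arrVm a) (arrAm a))
        (embCheck⇒ (quiver conePQ₁) (quiver CQ) (coneVm (PQ 1) (quiver Q) (arrVm a))
                   (coneAm (PQ 1) (quiver Q) (arrVm a) (arrAm a)) p) ∷ build B ps

record LimData (Q : Sort) : Set where
  field
    cQ    : Sort                      -- cone(Q)
    ccQ   : Sort                      -- cone(cone(Q))
    iQ    : Emb Q cQ                  -- i_Q
    arrsQ : List (Emb conePQ₁ cQ)     -- cone(a), a ∈ A_Q
    icQ   : Emb cQ ccQ                -- i_{cone(Q)}
    arrsC : List (Emb conePQ₁ ccQ)    -- cone(a), a ∈ A_{cone(Q)}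
    ciQ   : Emb cQ ccQ                -- cone(i_Q)

cone∅ : Sort
cone∅ = coneS ∅S id

cone∅≡PQ₀ : cone∅ ≡ PQS 0
cone∅≡PQ₀ = refl

limData∅ : LimData ∅S
limData∅ = record
  { cQ = cone∅ ; ccQ = cc ; iQ = iE ∅S cone∅ ; arrsQ = coneArrs ∅S cone∅
  ; icQ = iE cone∅ cc ; arrsC = coneArrs cone∅ cc ; ciQ = coneE (iE ∅S cone∅) cone∅ cc }
  where
  cc = coneS cone∅ (coneRank (quiver ∅S) id)

coneD₂ : Sort
coneD₂ = coneS D₂ id

limDataD₂ : LimData D₂
limDataD₂ = record
  { cQ = coneD₂ ; ccQ = cc ; iQ = iE D₂ coneD₂ ; arrsQ = coneArrs D₂ coneD₂
  ; icQ = iE coneD₂ cc ; arrsC = coneArrs coneD₂ cc ; ciQ = coneE (iE D₂ coneD₂) coneD₂ cc }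
  where
  cc = coneS coneD₂ (coneRank (quiver D₂) id)

-- K = cone(Q₀): v₀ = 3, arrows a_a = 2 : 3 → 0, a_b = 3 : 3 → 1, a_o = 4 : 3 → 2
KS : Sort
KS = coneS Q₀S rQ₀

limDataQ₀ : LimData Q₀S
limDataQ₀ = record
  { cQ = KS ; ccQ = cc ; iQ = iE Q₀S KS ; arrsQ = coneArrs Q₀S KS
  ; icQ = iE KS cc ; arrsC = coneArrs KS cc ; ciQ = coneE (iE Q₀S KS) KS cc }
  where
  cc = coneS KS (coneRank (quiver Q₀S) rQ₀)

-- Many-sorted first-order syntax over Σ (with equality ≈).
-- Variables are de Bruijn indices into a context of sorts.

Ctx : Set
Ctx = List Sort

data _∋_ : Ctx → Sort → Set where
  here  : ∀ {Γ Q} → (Q ∷ Γ) ∋ Q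
  there : ∀ {Γ Q R} → Γ ∋ Q → (R ∷ Γ) ∋ Q

data Term (Γ : Ctx) : Sort → Set where
  var   : ∀ {Q} → Γ ∋ Q → Term Γ Q
  restr : ∀ {Q Q'} → Emb Q' Q → Term Γ Q → Term Γ Q'

infix  4 _≈_
infixr 3 _∧'_
infixr 2 _∨'_
infixr 1 _⇒'_ _⇔'_

data Formula (Γ : Ctx) : Set₁ where
  _≈_     : ∀ {Q} → Term Γ Q → Term Γ Q → Formula Γ
  commute : ∀ {Q} → Term Γ Q → Formula Γ
  ⊤' ⊥'   : Formula Γ
  ¬'_     : Formula Γ → Formula Γ
  _∧'_ _∨'_ _⇒'_ : Formula Γ → Formula Γ → Formula Γ
  ∀' ∃'   : (Q : Sort) → Formula (Q ∷ Γ) → Formula Γ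
  -- conjunction of a family of formulas (only used for finite families)
  ⋀       : (I : Set) → (I → Formula Γ) → Formula Γ

_⇔'_ : ∀ {Γ} → Formula Γ → Formula Γ → Formula Γ
φ ⇔' ψ = (φ ⇒' ψ) ∧' (ψ ⇒' φ)

⋀L : ∀ {Γ} → List (Formula Γ) → Formula Γ
⋀L = foldr _∧'_ ⊤'

Ren Sub : Ctx → Ctx → Set
Ren Γ Δ = ∀ {Q} → Γ ∋ Q → Δ ∋ Q
Sub Γ Δ = ∀ {Q} → Γ ∋ Q → Term Δ Q

liftR : ∀ {Γ Δ R} → Ren Γ Δ → Ren (R ∷ Γ) (R ∷ Δ)
liftR ρ here = here
liftR ρ (there x) = there (ρ x)

renT : ∀ {Γ Δ Q} → Ren Γ Δ → Term Γ Q → Term Δ Q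
renT ρ (var x) = var (ρ x)
renT ρ (restr m t) = restr m (renT ρ t)

wk : ∀ {Γ Q R} → Term Γ Q → Term (R ∷ Γ) Q
wk = renT there

liftS : ∀ {Γ Δ R} → Sub Γ Δ → Sub (R ∷ Γ) (R ∷ Δ)
liftS σ here = var here
liftS σ (there x) = wk (σ x)

subT : ∀ {Γ Δ Q} → Sub Γ Δ → Term Γ Q → Term Δ Q
subT σ (var x) = σ x
subT σ (restr m t) = restr m (subT σ t)

subF : ∀ {Γ Δ} → Sub Γ Δ → Formula Γ → Formula Δ
subF σ (s ≈ t) = subT σ s ≈ subT σ t
subF σ (commute t) = commute (subT σ t)
subF σ ⊤' = ⊤'
subF σ ⊥' = ⊥'
subF σ (¬' φ) = ¬' subF σ φ
subF σ (φ ∧' ψ) = subF σ φ ∧' subF σ ψ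
subF σ (φ ∨' ψ) = subF σ φ ∨' subF σ ψ
subF σ (φ ⇒' ψ) = subF σ φ ⇒' subF σ ψ
subF σ (∀' Q φ) = ∀' Q (subF (liftS σ) φ)
subF σ (∃' Q φ) = ∃' Q (subF (liftS σ) φ)
subF σ (⋀ I f) = ⋀ I (λ i → subF σ (f i))

∃!' : ∀ {Γ} (Q : Sort) → Formula (Q ∷ Γ) → Formula Γ
∃!' {Γ} Q φ = ∃' Q (φ ∧' ∀' Q (subF σ φ ⇒' (var here ≈ var (there here))))
  where
  σ : Sub (Q ∷ Γ) (Q ∷ Q ∷ Γ)
  σ here = var here
  σ (there x) = var (there (there x))

†var : ∀ {Γ Q} → Γ ∋ Q → map _†S Γ ∋ (Q †S)
†var here = here
†var (there x) = there (†var x)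

†T : ∀ {Γ Q} → Term Γ Q → Term (map _†S Γ) (Q †S)
†T (var x) = var (†var x)
†T (restr m t) = restr (m †E) (†T t)

_†F : ∀ {Γ} → Formula Γ → Formula (map _†S Γ)
(s ≈ t) †F = †T s ≈ †T t
commute t †F = commute (†T t)
⊤' †F = ⊤'
⊥' †F = ⊥'
(¬' φ) †F = ¬' (φ †F)
(φ ∧' ψ) †F = (φ †F) ∧' (ψ †F)
(φ ∨' ψ) †F = (φ †F) ∨' (ψ †F)
(φ ⇒' ψ) †F = (φ †F) ⇒' (ψ †F)
∀' Q φ †F = ∀' (Q †S) (φ †F)
∃' Q φ †F = ∃' (Q †S) (φ †F)
⋀ I f †F = ⋀ I (λ i → f i †F)

record Structure : Set₁ where
  field
    Carrier  : Sort → Set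
    restrᴹ   : ∀ {Q Q'} → Emb Q' Q → Carrier Q → Carrier Q'
    commuteᴹ : (Q : Sort) → Carrier Q → Set
open Structure public

module Semantics (𝓜 : Structure) where
  data Env : Ctx → Set where
    []  : Env []
    _∷_ : ∀ {Q Γ} → Carrier 𝓜 Q → Env Γ → Env (Q ∷ Γ)

  lookupEnv : ∀ {Γ Q} → Env Γ → Γ ∋ Q → Carrier 𝓜 Q
  lookupEnv (x ∷ ρ) here = x
  lookupEnv (x ∷ ρ) (there v) = lookupEnv ρ v

  ⟦_⟧T : ∀ {Γ Q} → Term Γ Q → Env Γ → Carrier 𝓜 Q
  ⟦ var v ⟧T ρ = lookupEnv ρ v
  ⟦ restr m t ⟧T ρ = restrᴹ 𝓜 m (⟦ t ⟧T ρ)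

  ⟦_⟧F : ∀ {Γ} → Formula Γ → Env Γ → Set
  ⟦ s ≈ t ⟧F ρ = ⟦ s ⟧T ρ ≡ ⟦ t ⟧T ρ
  ⟦ commute {Q} t ⟧F ρ = commuteᴹ 𝓜 Q (⟦ t ⟧T ρ)
  ⟦ ⊤' ⟧F ρ = ⊤
  ⟦ ⊥' ⟧F ρ = ⊥
  ⟦ ¬' φ ⟧F ρ = ¬ ⟦ φ ⟧F ρ
  ⟦ φ ∧' ψ ⟧F ρ = ⟦ φ ⟧F ρ × ⟦ ψ ⟧F ρ
  ⟦ φ ∨' ψ ⟧F ρ = ⟦ φ ⟧F ρ ⊎ ⟦ ψ ⟧F ρ
  ⟦ φ ⇒' ψ ⟧F ρ = ⟦ φ ⟧F ρ → ⟦ ψ ⟧F ρ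
  ⟦ ∀' Q φ ⟧F ρ = (x : Carrier 𝓜 Q) → ⟦ φ ⟧F (x ∷ ρ)
  ⟦ ∃' Q φ ⟧F ρ = Σ (Carrier 𝓜 Q) (λ x → ⟦ φ ⟧F (x ∷ ρ))
  ⟦ ⋀ I f ⟧F ρ = (i : I) → ⟦ f i ⟧F ρ

_⊨_ : Structure → Formula [] → Set
𝓜 ⊨ φ = Semantics.⟦_⟧F 𝓜 φ Semantics.[]

private
  v0 : ∀ {Γ Q} → Term (Q ∷ Γ) Q
  v0 = var here
  v1 : ∀ {Γ Q R} → Term (R ∷ Q ∷ Γ) Q
  v1 = var (there here)
  v2 : ∀ {Γ Q R S} → Term (S ∷ R ∷ Q ∷ Γ) Q
  v2 = var (there (there here))
  v3 : ∀ {Γ Q R S U} → Term (U ∷ S ∷ R ∷ Q ∷ Γ) Q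
  v3 = var (there (there (there here)))
  v4 : ∀ {Γ Q R S U W} → Term (W ∷ U ∷ S ∷ R ∷ Q ∷ Γ) Q
  v4 = var (there (there (there (there here))))
  v5 : ∀ {Γ Q R S U W X} → Term (X ∷ W ∷ U ∷ S ∷ R ∷ Q ∷ Γ) Q
  v5 = var (there (there (there (there (there here)))))

Cospan : ∀ {Γ Q₁ Q₂ Q'} → Emb Q₁ Q' → Emb Q₂ Q' → Term Γ Q₁ → Term Γ Q₂ → Term Γ Q' → Formula Γ
Cospan m₁' m₂' x₁ x₂ x' = (restr m₁' x' ≈ x₁) ∧' (restr m₂' x' ≈ x₂)

EmptyEU : Formula []
EmptyEU = ∃!' ∅S ⊤'

IsComp : ∀ {Q Q' Q''} → Emb Q'' Q' → Emb Q' Q → Emb Q'' Q → Set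
IsComp {Q'' = Q''} m m' n =
  (∀ v → v ∈ V (quiver Q'') → mapV n v ≡ mapV m' (mapV m v)) ×
  (∀ a → a ∈ names (quiver Q'') → mapA n a ≡ mapA m' (mapA m a))

RestrComp : ∀ {Q Q' Q''} → Emb Q'' Q' → Emb Q' Q → Emb Q'' Q → Formula []
RestrComp {Q} m m' n = ∀' Q (restr m (restr m' v0) ≈ restr n v0)

ImV ImA : ∀ {Q' Q} → Emb Q' Q → ℕ → Set
ImV {Q'} e v = ∃ λ u → u ∈ V (quiver Q') × mapV e u ≡ v
ImA {Q'} e a = ∃ λ u → u ∈ names (quiver Q') × mapA e u ≡ a

record PushoutConf : Set where
  field
    Q Q₁ Q₂ Q' : Sort
    m₁  : Emb Q Q₁
    m₂  : Emb Q Q₂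
    m₁' : Emb Q₁ Q'
    m₂' : Emb Q₂ Q'
    commV : ∀ v → v ∈ V (quiver Q) → mapV m₁' (mapV m₁ v) ≡ mapV m₂' (mapV m₂ v)
    commA : ∀ a → a ∈ names (quiver Q) → mapA m₁' (mapA m₁ a) ≡ mapA m₂' (mapA m₂ a)
    coverV : ∀ v → v ∈ V (quiver Q') → ImV m₁' v ⊎ ImV m₂' v
    coverA : ∀ a → a ∈ names (quiver Q') → ImA m₁' a ⊎ ImA m₂' a
    interV : ∀ v → v ∈ V (quiver Q') →
             (∃ λ u → u ∈ V (quiver Q) × mapV m₁' (mapV m₁ u) ≡ v) ⇔ (ImV m₁' v × ImV m₂' v)
    interA : ∀ a → a ∈ names (quiver Q') →
             (∃ λ u → u ∈ names (quiver Q) × mapA m₁' (mapA m₁ u) ≡ a) ⇔ (ImA m₁' a × ImA m₂' a)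

PushoutEU : PushoutConf → Formula []
PushoutEU P = ∀' Q₁ (∀' Q₂ ((restr m₁ v1 ≈ restr m₂ v0) ⇒' ∃!' Q' (Cospan m₁' m₂' v2 v1 v0)))
  where open PushoutConf P

Comp : ∀ {Γ} → Term Γ (PQS 1) → Term Γ (PQS 1) → Term Γ (PQS 1) → Formula Γ
Comp x y z = ∃' TS ((restr e₀₁ v0 ≈ wk x) ∧' (restr e₁₂ v0 ≈ wk y) ∧' (restr e₀₂ v0 ≈ wk z) ∧' commute v0)

CompE : Formula []
CompE = ∀' (PQS 1) (∀' (PQS 1) ((restr τE v1 ≈ restr σE v0) ⇒' ∃' (PQS 1) (Comp v2 v1 v0)))

EqPath⁺ : ∀ {Γ} n₁ n₂ → Term Γ (PQS (suc n₁)) → Term Γ (PQS (suc n₂)) → Formula Γ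
EqPath⁺ n₁ n₂ x₁ x₂ =
  (restr (stE n₁) x₁ ≈ restr (stE n₂) x₂) ∧'
  ∀' BS (Cospan m₁'E m₂'E (wk x₁) (wk x₂) v0 ⇒' commute v0)
  where open Bigon n₁ n₂

Id : ∀ {Γ} → Term Γ (PQS 0) → Term Γ (PQS 1) → Formula Γ
Id x y = (restr σE y ≈ x) ∧'
  ∀' (PQS 1) (∀' (PQS 1) ((Comp (wk (wk y)) v1 v0 ⇒' EqPath⁺ 0 0 v1 v0) ∧'
                          (Comp v1 (wk (wk y)) v0 ⇒' EqPath⁺ 0 0 v1 v0)))

IdE : Formula []
IdE = ∀' (PQS 0) (∃' (PQS 1) (Id v1 v0))

EqPath : ∀ {Γ} k₁ k₂ → Term Γ (PQS k₁) → Term Γ (PQS k₂) → Formula Γ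
EqPath zero zero x y = x ≈ y
EqPath zero (suc n) x y = ∃' (PQS 1) (Id (wk x) v0 ∧' EqPath⁺ 0 n v0 (wk y))
EqPath (suc n) zero x y = EqPath zero (suc n) y x
EqPath (suc n₁) (suc n₂) x y = EqPath⁺ n₁ n₂ x y

EqPathRefl : ℕ → Formula []
EqPathRefl k = ∀' (PQS k) (EqPath k k v0 v0)

EqPathSym : ℕ → ℕ → Formula []
EqPathSym k₁ k₂ = ∀' (PQS k₁) (∀' (PQS k₂) (EqPath k₁ k₂ v1 v0 ⇒' EqPath k₂ k₁ v0 v1))

EqPathTrans : ℕ → ℕ → ℕ → Formula []
EqPathTrans k₁ k₂ k₃ =
  ∀' (PQS k₁) (∀' (PQS k₂) (∀' (PQS k₃)
    ((EqPath k₁ k₂ v2 v1 ∧' EqPath k₂ k₃ v1 v0) ⇒' EqPath k₁ k₃ v2 v0)))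

EqPathConcat : ℕ → ℕ → ℕ → ℕ → Formula []
EqPathConcat k₁ k₂ k₁' k₂' =
  ∀' (PQS k₁) (∀' (PQS k₂) (∀' (PQS k₁') (∀' (PQS k₂')
    ((EqPath k₁ k₂ v3 v2 ∧' EqPath k₁' k₂' v1 v0 ∧'
      (restr (tpE 0 k₁ z≤n) v3 ≈ restr (spE 0 k₁' z≤n) v1)) ⇒'
     ∀' (PQS (k₁ + k₁')) (∀' (PQS (k₂ + k₂'))
       ((Cospan (spE k₁ (k₁ + k₁') (m≤m+n k₁ k₁')) (tpE k₁' (k₁ + k₁') (m≤n+m k₁' k₁)) v5 v3 v1 ∧'
         Cospan (spE k₂ (k₂ + k₂') (m≤m+n k₂ k₂')) (tpE k₂' (k₂ + k₂') (m≤n+m k₂' k₂)) v4 v2 v0) ⇒'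
        EqPath (k₁ + k₁') (k₂ + k₂') v1 v0))))))

ComEq : Formula []
ComEq = ∀' C₂ (commute v0 ⇒' (restr a₀E v0 ≈ restr a₁E v0))

record BPair (Q : Sort) : Set where
  field
    k₁ k₂ : ℕ
    vm₁ am₁ vm₂ am₂ : List ℕ
    path₁ : IsMorphism (PQ k₁) (quiver Q) vm₁ am₁
    path₂ : IsMorphism (PQ k₂) (quiver Q) vm₂ am₂
    sameStart : app (V (PQ k₁)) vm₁ 0 ≡ app (V (PQ k₂)) vm₂ 0
    sameEnd   : app (V (PQ k₁)) vm₁ k₁ ≡ app (V (PQ k₂)) vm₂ k₂

pathEmb : (Q : Sort) → ∀ k vm am → IsMorphism (PQ k) (quiver Q) vm am → Emb (PQS k) Q
pathEmb (mkS q ac) k vm am p = mkE vm am (ac k vm am p)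

PathCom : Sort → Formula []
PathCom Q = ∀' Q (⋀ (BPair Q) conj ⇔' commute v0)
  where
  conj : BPair Q → Formula (Q ∷ [])
  conj b = EqPath k₁ k₂ (restr (pathEmb Q k₁ vm₁ am₁ path₁) v0) (restr (pathEmb Q k₂ vm₂ am₂ path₂) v0)
    where open BPair b

data 𝒯cat : Formula [] → Set₁ where
  emptyEU   : 𝒯cat EmptyEU
  restrComp : ∀ {Q Q' Q''} (m : Emb Q'' Q') (m' : Emb Q' Q) (n : Emb Q'' Q) →
              IsComp m m' n → 𝒯cat (RestrComp m m' n)
  pushoutEU : (P : PushoutConf) → 𝒯cat (PushoutEU P)
  compE     : 𝒯cat CompE
  idE       : 𝒯cat IdE
  eqRefl    : ∀ k → 𝒯cat (EqPathRefl k)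
  eqSym     : ∀ k₁ k₂ → 𝒯cat (EqPathSym k₁ k₂)
  eqTrans   : ∀ k₁ k₂ k₃ → 𝒯cat (EqPathTrans k₁ k₂ k₃)
  eqConcat  : ∀ k₁ k₂ k₁' k₂' → 𝒯cat (EqPathConcat k₁ k₂ k₁' k₂')
  comEq     : 𝒯cat ComEq
  pathCom   : ∀ Q → 𝒯cat (PathCom Q)

fM : Emb (PQS 1) MS
fM = mkEmbD (PQS 1) MS (1 ∷ 2 ∷ []) (2 ∷ [])

triGFK triHFK : Emb TS MS
triGFK = mkEmbD TS MS (0 ∷ 1 ∷ 2 ∷ []) (0 ∷ 3 ∷ 2 ∷ [])
triHFK = mkEmbD TS MS (0 ∷ 1 ∷ 2 ∷ []) (1 ∷ 3 ∷ 2 ∷ [])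

ghM : Emb C₂ MS
ghM = mkEmbD C₂ MS (0 ∷ 1 ∷ []) (0 ∷ 1 ∷ [])

Mono : ∀ {Γ} → Term Γ (PQS 1) → Formula Γ
Mono x = ∀' MS (((restr fM v0 ≈ wk x) ∧' commute (restr triGFK v0) ∧' commute (restr triHFK v0))
                ⇒' commute (restr ghM v0))

ConeF : ∀ {Γ Q CQ} → Emb Q CQ → List (Emb conePQ₁ CQ) → Term Γ Q → Term Γ CQ → Formula Γ
ConeF i arrs x y = (restr i y ≈ x) ∧' ⋀L (map (λ e → commute (restr e y)) arrs)

Limit : ∀ {Γ Q} (L : LimData Q) → Term Γ Q → Term Γ (LimData.cQ L) → Formula Γ
Limit L x y =
  ConeF iQ arrsQ x y ∧'
  ∀' cQ (ConeF iQ arrsQ (wk x) v0 ⇒'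
         ∃!' ccQ (ConeF icQ arrsC (wk (wk y)) v0 ∧' (restr ciQ v0 ≈ v1)))
  where open LimData L

-- Colimit_∅ := (Limit_{∅†})†   (note ∅† = ∅ and cone(∅)† = cone(∅) = PQ₀)
Colimit∅ : ∀ {Γ} → Term Γ ∅S → Term Γ (PQS 0) → Formula Γ
Colimit∅ {Γ} x y = subF σ (Limit limData∅ v1 v0 †F)
  where
  σ : Sub (map _†S (cone∅ ∷ ∅S ∷ [])) Γ
  σ here = y
  σ (there here) = x

Zero : ∀ {Γ} → Term Γ (PQS 0) → Formula Γ
Zero x = ∀' ∅S (Limit limData∅ v0 (wk x) ∧' Colimit∅ v0 (wk x))

fK : Emb (PQS 1) KS
fK = mkEmbD (PQS 1) KS (0 ∷ 1 ∷ []) (0 ∷ [])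

aaK : Emb (PQS 1) KS
aaK = mkEmbD (PQS 1) KS (3 ∷ 0 ∷ []) (2 ∷ [])

oK : Emb (PQS 0) KS
oK = mkEmbD (PQS 0) KS (2 ∷ []) []

Ker : ∀ {Γ} → Term Γ (PQS 1) → Term Γ (PQS 1) → Formula Γ
Ker x y = ∃' KS ((restr fK v0 ≈ wk x) ∧' (restr aaK v0 ≈ wk y) ∧' Zero (restr oK v0) ∧'
                 Limit limDataQ₀ (restr (LimData.iQ limDataQ₀) v0) v0)

ZeroE : Formula []
ZeroE = ∃' (PQS 0) (Zero v0)

ProductE : Formula []
ProductE = ∀' D₂ (∃' coneD₂ (Limit limDataD₂ v1 v0))

CoproductE : Formula []
CoproductE = ProductE †F

KerE : Formula []
KerE = ∀' (PQS 1) (∃' (PQS 1) (Ker v1 v0))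

CokerE : Formula []
CokerE = KerE †F

MonoNormal : Formula []
MonoNormal = ∀' (PQS 1) (Mono v0 ⇒' ∃' (PQS 1) (Ker v0 v1))

EpiNormal : Formula []
EpiNormal = MonoNormal †F

data 𝒯ab : Formula [] → Set₁ where
  cat        : ∀ {φ} → 𝒯cat φ → 𝒯ab φ
  zeroE      : 𝒯ab ZeroE
  productE   : 𝒯ab ProductE
  coproductE : 𝒯ab CoproductE
  kerE       : 𝒯ab KerE
  cokerE     : 𝒯ab CokerE
  monoNormal : 𝒯ab MonoNormal
  epiNormal  : 𝒯ab EpiNormal

_⊨Th_ : Structure → (Formula [] → Set₁) → Set₁
𝓜 ⊨Th 𝒯 = ∀ φ → 𝒯 φ → 𝓜 ⊨ φ

_†Th : (Formula [] → Set₁) → Formula [] → Set₁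
(𝒯 †Th) ψ = Σ (Formula []) (λ φ → 𝒯 φ × (φ †F) ≡ ψ)

-- Duality is realised by restriction along isomorphisms Q ≅ Q†. Reversal i ↦ k ∸ i identifies
-- the path quiver PQ_k with its dual, and similar reversals identify T, C₂ and the bigons
-- (the two parallel paths glued at their ends, used in EqPath) with theirs. In a model of 𝒯cat
-- restriction is functorial (restriction along the identity is trivial by uniqueness in the
-- pushout of identities) and preserves commutativity (by PathCom), so restricting along these
-- isomorphisms turns the dual predicates Comp†, Id†, EqPath† into Comp, Id, EqPath of the
-- reversed paths, with the order of composition and of concatenation swapped. Each dual axiom of
-- 𝒯cat thereby becomes an instance of an axiom of 𝒯cat; the remaining axioms of 𝒯ab come in dual
-- pairs, except ZeroE, whose dual only swaps the limit and colimit conditions.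

module Submission where

open import Defs
open import Level using (0ℓ)
open import Axiom.ExcludedMiddle using (ExcludedMiddle)
open import Function using (id)
open import Function.Bundles using (_⇔_; mk⇔; Equivalence)
open Equivalence using (to; from)
open import Data.Bool using (Bool; true; false; T; if_then_else_)
open import Data.Nat using (ℕ; zero; suc; _+_; _∸_; _<_; _≤_; _≡ᵇ_; _<ᵇ_; _≤ᵇ_; z≤n; s≤s; _≟_; _≤?_; _<?_)
open import Data.Nat.Properties
open import Data.Product using (Σ; _×_; _,_; proj₁; proj₂; swap)
import Data.Sum as Sum
open import Data.Sum using (inj₁; inj₂)
open import Data.Unit using (tt)
open import Data.Empty using (⊥-elim)
open import Data.List using (List; []; _∷_; map; length)
open import Data.List.Properties using (length-map)
open import Data.List.Membership.Propositional using (_∈_)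
open import Data.List.Membership.Propositional.Properties using (∈-map⁺; ∈-map⁻; ∈-upTo⁺; ∈-upTo⁻)
open import Data.List.Relation.Unary.Any using (here; there)
import Data.List.Relation.Unary.All as All
open import Relation.Binary.PropositionalEquality
open import Relation.Nullary using (¬_; yes; no)
open import Relation.Nullary.Decidable using (recompute)

app-∘ : ∀ X ys (g : ℕ → ℕ) x → length ys ≡ length X → x ∈ X →
        app X (map g ys) x ≡ g (app X ys x)
app-∘ (x' ∷ X) (y ∷ ys) g x len x∈ with x' ≡ᵇ x in eq
... | true = refl
... | false with x∈
...   | here refl = ⊥-elim (subst T eq (≡⇒≡ᵇ x x refl))
...   | there p = app-∘ X ys g x (suc-injective len) p

-- The proofs inside quivers and embeddings are irrelevant, but being decidable they can be recomputed.

recomputeMorphism : ∀ {Q Q' vm am} → .(IsMorphism Q Q' vm am) → IsMorphism Q Q' vm am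
recomputeMorphism {Q} {Q'} {vm} {am} m =
  recompute (length vm ≟ length (V Q)) (proj₁ m) ,
  recompute (length am ≟ length (A Q)) (proj₁ (proj₂ m)) ,
  (λ v p → recompute (app (V Q) vm v ∈ℕ? V Q') (proj₁ (proj₂ (proj₂ m)) v p)) ,
  (λ a s t p → recompute (_ ∈A? A Q') (proj₂ (proj₂ (proj₂ m)) a s t p))

recomputeInjOn : ∀ {X f} → .(InjOn X f) → InjOn X f
recomputeInjOn i x y p q e = recompute (x ≟ y) (i x y p q e)

module _ {Q Q' : Sort} where
  isMorphism : (e : Emb Q Q') → IsMorphism (quiver Q) (quiver Q') (vm e) (am e)
  isMorphism (mkE _ _ p) = recomputeMorphism {quiver Q} {quiver Q'} (proj₁ p)

  mapV-injective : (e : Emb Q Q') → InjOn (V (quiver Q)) (mapV e)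
  mapV-injective (mkE _ _ p) = recomputeInjOn (proj₁ (proj₂ p))

  mapA-injective : (e : Emb Q Q') → InjOn (names (quiver Q)) (mapA e)
  mapA-injective (mkE _ _ p) = recomputeInjOn (proj₂ (proj₂ p))

  length-vm : (e : Emb Q Q') → length (vm e) ≡ length (V (quiver Q))
  length-vm e = proj₁ (isMorphism e)

  length-am : (e : Emb Q Q') → length (am e) ≡ length (names (quiver Q))
  length-am e = trans (proj₁ (proj₂ (isMorphism e))) (sym (length-map name (A (quiver Q))))

  mapV-∈ : (e : Emb Q Q') → ∀ v → v ∈ V (quiver Q) → mapV e v ∈ V (quiver Q')
  mapV-∈ e = proj₁ (proj₂ (proj₂ (isMorphism e)))

  mapArr-∈ : (e : Emb Q Q') → ∀ a s t → (a , s , t) ∈ A (quiver Q) →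
             (mapA e a , mapV e s , mapV e t) ∈ A (quiver Q')
  mapArr-∈ e = proj₂ (proj₂ (proj₂ (isMorphism e)))

src-∈ : ∀ (Q : Sort) {a s t} → (a , s , t) ∈ A (quiver Q) → s ∈ V (quiver Q)
src-∈ (mkS (mkQ VQ AQ w) _) {s = s} p = recompute (s ∈ℕ? VQ) (proj₁ (All.lookup (proj₂ (proj₂ w)) p))

tgt-∈ : ∀ (Q : Sort) {a s t} → (a , s , t) ∈ A (quiver Q) → t ∈ V (quiver Q)
tgt-∈ (mkS (mkQ VQ AQ w) _) {t = t} p = recompute (t ∈ℕ? VQ) (proj₂ (All.lookup (proj₂ (proj₂ w)) p))

name-∈ : ∀ (Q : Sort) {a s t} → (a , s , t) ∈ A (quiver Q) → a ∈ names (quiver Q)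
name-∈ Q p = ∈-map⁺ name p

mapA-∈ : ∀ {Q Q'} (e : Emb Q Q') a → a ∈ names (quiver Q) → mapA e a ∈ names (quiver Q')
mapA-∈ {Q} {Q'} e a p with ∈-map⁻ name p
... | (a , s , t) , q , refl = name-∈ Q' (mapArr-∈ e a s t q)

∘-isMorphism : ∀ (P : Sort) {Q Q'} {vm am} → IsMorphism (quiver P) (quiver Q) vm am → (e : Emb Q Q') →
               IsMorphism (quiver P) (quiver Q') (map (mapV e) vm) (map (mapA e) am)
∘-isMorphism P {Q' = Q'} {vm} {am} (lenV , lenA , mapV∈ , mapArr∈) e =
  trans (length-map _ vm) lenV , trans (length-map _ am) lenA ,
  (λ v p → subst (_∈ V (quiver Q')) (sym (app-∘ _ vm _ v lenV p)) (mapV-∈ e _ (mapV∈ v p))) ,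
  (λ a s t p → subst₂ (λ x y → (x , y) ∈ A (quiver Q'))
     (sym (app-∘ _ am _ a lenA' (name-∈ P p)))
     (sym (cong₂ _,_ (app-∘ _ vm _ s lenV (src-∈ P p)) (app-∘ _ vm _ t lenV (tgt-∈ P p))))
     (mapArr-∈ e _ _ _ (mapArr∈ a s t p)))
  where lenA' = trans lenA (sym (length-map name (A (quiver P))))

_∘E_ : ∀ {QA QB QC} → Emb QB QC → Emb QA QB → Emb QA QC
_∘E_ {QA} {QB} {QC} f e = mkE (map (mapV f) (vm e)) (map (mapA f) (am e)) isEmb∘
  where
  .isEmb∘ : IsEmbedding (quiver QA) (quiver QC) (map (mapV f) (vm e)) (map (mapA f) (am e))
  isEmb∘ =
    ∘-isMorphism QA (isMorphism e) f ,
    (λ x y p q eq → mapV-injective e x y p q (mapV-injective f _ _ (mapV-∈ e x p) (mapV-∈ e y q)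
        (trans (sym (app-∘ _ _ _ x (length-vm e) p)) (trans eq (app-∘ _ _ _ y (length-vm e) q))))) ,
    (λ x y p q eq → mapA-injective e x y p q (mapA-injective f _ _ (mapA-∈ e x p) (mapA-∈ e y q)
        (trans (sym (app-∘ _ _ _ x (length-am e) p)) (trans eq (app-∘ _ _ _ y (length-am e) q)))))

∘E-isComp : ∀ {QA QB QC} (e : Emb QA QB) (f : Emb QB QC) → IsComp e f (f ∘E e)
∘E-isComp e f = (λ v p → app-∘ _ _ _ v (length-vm e) p) , (λ a p → app-∘ _ _ _ a (length-am e) p)

mkEmbF : (Q Q' : Sort) (f g : ℕ → ℕ) →
  (∀ v → v ∈ V (quiver Q) → f v ∈ V (quiver Q')) →
  (∀ a s t → (a , s , t) ∈ A (quiver Q) → (g a , f s , f t) ∈ A (quiver Q')) →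
  InjOn (V (quiver Q)) f → InjOn (names (quiver Q)) g → Emb Q Q'
mkEmbF Q Q' f g hv ha iv ia = mkE (map f VQ) (map g NQ) isEmbF
  where
  VQ = V (quiver Q)
  NQ = names (quiver Q)
  .isEmbF : IsEmbedding (quiver Q) (quiver Q') (map f VQ) (map g NQ)
  isEmbF =
    (length-map f VQ , trans (length-map g NQ) (length-map name (A (quiver Q))) ,
     (λ v p → subst (_∈ V (quiver Q')) (sym (app-map VQ f v p)) (hv v p)) ,
     (λ a s t p → subst₂ (λ x y → (x , y) ∈ A (quiver Q'))
        (sym (app-map NQ g a (name-∈ Q p)))
        (sym (cong₂ _,_ (app-map VQ f s (src-∈ Q p)) (app-map VQ f t (tgt-∈ Q p))))
        (ha a s t p))) ,
    (λ x y p q e → iv x y p q (trans (sym (app-map VQ f x p)) (trans e (app-map VQ f y q)))) ,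
    (λ x y p q e → ia x y p q (trans (sym (app-map NQ g x p)) (trans e (app-map NQ g y q))))

idEmb : (Q : Sort) → Emb Q Q
idEmb Q = mkEmbF Q Q id id (λ v p → p) (λ a s t p → p) (λ x y p q e → e) (λ x y p q e → e)

idEmb-mapV : ∀ Q v → v ∈ V (quiver Q) → mapV (idEmb Q) v ≡ v
idEmb-mapV Q v p = app-map (V (quiver Q)) id v p

idEmb-mapA : ∀ Q a → a ∈ names (quiver Q) → mapA (idEmb Q) a ≡ a
idEmb-mapA Q a p = app-map (names (quiver Q)) id a p

Square : ∀ {QA QB QC QD} → Emb QA QB → Emb QB QC → Emb QA QD → Emb QD QC → Set
Square {QA} e₁ f₁ e₂ f₂ =
  (∀ v → v ∈ V (quiver QA) → mapV f₁ (mapV e₁ v) ≡ mapV f₂ (mapV e₂ v)) ×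
  (∀ a → a ∈ names (quiver QA) → mapA f₁ (mapA e₁ a) ≡ mapA f₂ (mapA e₂ a))

record Iso (Q Q' : Sort) : Set where
  field
    fwd : Emb Q Q'
    bwd : Emb Q' Q
    bwd∘fwd : IsComp fwd bwd (idEmb Q)
    fwd∘bwd : IsComp bwd fwd (idEmb Q')

mkIso : ∀ {Q Q'} (f : Emb Q Q') (g : Emb Q' Q) →
  (∀ v → v ∈ V (quiver Q) → mapV g (mapV f v) ≡ v) → (∀ a → a ∈ names (quiver Q) → mapA g (mapA f a) ≡ a) →
  (∀ v → v ∈ V (quiver Q') → mapV f (mapV g v) ≡ v) → (∀ a → a ∈ names (quiver Q') → mapA f (mapA g a) ≡ a) →
  Iso Q Q'
mkIso {Q} {Q'} f g gfV gfA fgV fgA = record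
  { fwd = f ; bwd = g
  ; bwd∘fwd = (λ v p → trans (idEmb-mapV Q v p) (sym (gfV v p))) , (λ a p → trans (idEmb-mapA Q a p) (sym (gfA a p)))
  ; fwd∘bwd = (λ v p → trans (idEmb-mapV Q' v p) (sym (fgV v p))) , (λ a p → trans (idEmb-mapA Q' a p) (sym (fgA a p))) }

identityPushout : Sort → PushoutConf
identityPushout Q = record
  { Q = Q ; Q₁ = Q ; Q₂ = Q ; Q' = Q ; m₁ = i ; m₂ = i ; m₁' = i ; m₂' = i
  ; commV = λ v p → refl ; commA = λ a p → refl
  ; coverV = λ v p → inj₁ (v , p , idEmb-mapV Q v p) ; coverA = λ a p → inj₁ (a , p , idEmb-mapA Q a p)
  ; interV = λ v p → mk⇔ (λ (u , q , e) → let e' = trans (sym (cong (mapV i) (idEmb-mapV Q u q))) e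
                                          in (u , q , e') , (u , q , e'))
                        (λ ((u , q , e) , _) → u , q , trans (cong (mapV i) (idEmb-mapV Q u q)) e)
  ; interA = λ a p → mk⇔ (λ (u , q , e) → let e' = trans (sym (cong (mapA i) (idEmb-mapA Q u q))) e
                                          in (u , q , e') , (u , q , e'))
                        (λ ((u , q , e) , _) → u , q , trans (cong (mapA i) (idEmb-mapA Q u q)) e) }
  where i = idEmb Q

idEmb-isComp : ∀ Q → IsComp (idEmb Q) (idEmb Q) (idEmb Q)
idEmb-isComp Q = (λ v p → sym (cong (mapV (idEmb Q)) (idEmb-mapV Q v p))) ,
                 (λ a p → sym (cong (mapA (idEmb Q)) (idEmb-mapA Q a p)))


mapA-† : ∀ {Q' Q} (e : Emb Q' Q) x → mapA (e †E) x ≡ mapA e x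
mapA-† {Q'} e x = cong (λ N → app N (am e) x) (names-swap (A (quiver Q')))

names-†⁻ : ∀ {Q : Sort} {a} → a ∈ names (quiver (Q †S)) → a ∈ names (quiver Q)
names-†⁻ {Q} {a} = subst (a ∈_) (names-swap (A (quiver Q)))

names-†⁺ : ∀ {Q : Sort} {a} → a ∈ names (quiver Q) → a ∈ names (quiver (Q †S))
names-†⁺ {Q} {a} = subst (a ∈_) (sym (names-swap (A (quiver Q))))

IsComp-† : ∀ {Q Q' Q''} (m : Emb Q'' Q') (m' : Emb Q' Q) (n : Emb Q'' Q) → IsComp m m' n →
           IsComp (m †E) (m' †E) (n †E)
IsComp-† {Q'' = Q''} m m' n (compV , compA) =
  compV ,
  λ a p → trans (mapA-† n a) (trans (compA a (names-†⁻ {Q''} p))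
                 (sym (trans (mapA-† m' _) (cong (mapA m') (mapA-† m a)))))

ImA-†⁺ : ∀ {Q' Q} (e : Emb Q' Q) {a} → ImA e a → ImA (e †E) a
ImA-†⁺ {Q'} e (u , p , eq) = u , names-†⁺ {Q'} p , trans (mapA-† e u) eq

ImA-†⁻ : ∀ {Q' Q} (e : Emb Q' Q) {a} → ImA (e †E) a → ImA e a
ImA-†⁻ {Q'} e (u , p , eq) = u , names-†⁻ {Q'} p , trans (sym (mapA-† e u)) eq

PushoutConf-† : PushoutConf → PushoutConf
PushoutConf-† P = record
  { Q = Q †S ; Q₁ = Q₁ †S ; Q₂ = Q₂ †S ; Q' = Q' †S
  ; m₁ = m₁ †E ; m₂ = m₂ †E ; m₁' = m₁' †E ; m₂' = m₂' †E
  ; commV = commV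
  ; commA = λ a p → trans (diagA a) (trans (commA a (names-†⁻ {Q} p))
                     (sym (trans (mapA-† m₂' _) (cong (mapA m₂') (mapA-† m₂ a)))))
  ; coverV = coverV
  ; coverA = λ a p → Sum.map (ImA-†⁺ m₁') (ImA-†⁺ m₂') (coverA a (names-†⁻ {Q'} p))
  ; interV = interV
  ; interA = λ a p → mk⇔
      (λ { (u , q , eq) →
             let (i₁ , i₂) = to (interA a (names-†⁻ {Q'} p)) (u , names-†⁻ {Q} q , trans (sym (diagA u)) eq)
             in ImA-†⁺ m₁' i₁ , ImA-†⁺ m₂' i₂ })
      (λ { (i₁ , i₂) →
             let (u , q , eq) = from (interA a (names-†⁻ {Q'} p)) (ImA-†⁻ m₁' i₁ , ImA-†⁻ m₂' i₂)
             in u , names-†⁺ {Q} q , trans (diagA u) eq })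
  }
  where
  open PushoutConf P
  diagA : ∀ u → mapA (m₁' †E) (mapA (m₁ †E) u) ≡ mapA m₁' (mapA m₁ u)
  diagA u = trans (mapA-† m₁' _) (cong (mapA m₁') (mapA-† m₁ u))

m<n⇒1+[n∸1+m]≡n∸m : ∀ {m n} → m < n → suc (n ∸ suc m) ≡ n ∸ m
m<n⇒1+[n∸1+m]≡n∸m m<n = sym (+-∸-assoc 1 m<n)

m<n⇒n∸1+[n∸1+m]≡m : ∀ {m n} → m < n → n ∸ suc (n ∸ suc m) ≡ m
m<n⇒n∸1+[n∸1+m]≡m {m} {n} m<n = trans (cong (n ∸_) (m<n⇒1+[n∸1+m]≡n∸m m<n)) (m∸[m∸n]≡n (<⇒≤ m<n))

m<n⇒n∸1+m<n : ∀ {m n} → m < n → n ∸ suc m < n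
m<n⇒n∸1+m<n {m} {suc n} _ = s≤s (m∸n≤m n m)

∈VPQ : ∀ {k v} → v ∈ V (PQ k) → v ≤ k
∈VPQ p = ≤-pred (∈-upTo⁻ p)

∈VPQ⁺ : ∀ {k v} → v ≤ k → v ∈ V (PQ k)
∈VPQ⁺ p = ∈-upTo⁺ (s≤s p)

∈namesPQ† : ∀ {k x} → x ∈ names (PQ k †Q) → x < k
∈namesPQ† {k} p = ∈namesPQ {k} (names-†⁻ {PQS k} p)

∈namesPQ†⁺ : ∀ {k x} → x < k → x ∈ names (PQ k †Q)
∈namesPQ†⁺ {k} p = names-†⁺ {PQS k} (∈namesPQ⁺ p)

∈pqA† : ∀ {k a s t} → (a , s , t) ∈ A (PQ k †Q) → a < k × s ≡ suc a × t ≡ a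
∈pqA† {k} p with ∈pqA {k} (∈swap⁻ p)
... | a<k , refl , refl = a<k , refl , refl

revPQ : ∀ k → Emb (PQS k) (PQS k †S)
revPQ k = mkEmbF (PQS k) (PQS k †S) (k ∸_) (λ a → k ∸ suc a)
  (λ v p → ∈VPQ⁺ (m∸n≤m k v))
  (λ a s t p → reversed-arrow (∈pqA {k} p))
  (λ x y p q e → ∸-cancelˡ-≡ (∈VPQ p) (∈VPQ q) e)
  (λ x y p q e → suc-injective (∸-cancelˡ-≡ (∈namesPQ p) (∈namesPQ q) e))
  where
  reversed-arrow : ∀ {a s t} → a < k × s ≡ a × t ≡ suc a → (k ∸ suc a , k ∸ s , k ∸ t) ∈ A (PQ k †Q)
  reversed-arrow {a} (a<k , refl , refl) =
    subst (λ z → (k ∸ suc a , z , k ∸ suc a) ∈ A (PQ k †Q)) (m<n⇒1+[n∸1+m]≡n∸m a<k)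
      (∈swap⁺ (∈-map⁺ pqArr (∈-upTo⁺ (m<n⇒n∸1+m<n a<k))))

revPQ⁻ : ∀ k → Emb (PQS k †S) (PQS k)
revPQ⁻ k = mkEmbF (PQS k †S) (PQS k) (k ∸_) (λ a → k ∸ suc a)
  (λ v p → ∈VPQ⁺ (m∸n≤m k v))
  (λ a s t p → reversed-arrow (∈pqA† {k} p))
  (λ x y p q e → ∸-cancelˡ-≡ (∈VPQ p) (∈VPQ q) e)
  (λ x y p q e → suc-injective (∸-cancelˡ-≡ (∈namesPQ† p) (∈namesPQ† q) e))
  where
  reversed-arrow : ∀ {a s t} → a < k × s ≡ suc a × t ≡ a → (k ∸ suc a , k ∸ s , k ∸ t) ∈ A (PQ k)
  reversed-arrow {a} (a<k , refl , refl) =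
    subst (λ z → (k ∸ suc a , k ∸ suc a , z) ∈ A (PQ k)) (m<n⇒1+[n∸1+m]≡n∸m a<k)
      (∈-map⁺ pqArr (∈-upTo⁺ (m<n⇒n∸1+m<n a<k)))

module _ (k : ℕ) where
  revPQ-mapV : ∀ v → v ∈ V (PQ k) → mapV (revPQ k) v ≡ k ∸ v
  revPQ-mapV v p = app-map (V (PQ k)) (k ∸_) v p

  revPQ-mapA : ∀ a → a ∈ names (PQ k) → mapA (revPQ k) a ≡ k ∸ suc a
  revPQ-mapA a p = app-map (names (PQ k)) (λ a → k ∸ suc a) a p

  revPQ⁻-mapV : ∀ v → v ∈ V (PQ k) → mapV (revPQ⁻ k) v ≡ k ∸ v
  revPQ⁻-mapV v p = app-map (V (PQ k)) (k ∸_) v p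

  revPQ⁻-mapA : ∀ a → a ∈ names (PQ k †Q) → mapA (revPQ⁻ k) a ≡ k ∸ suc a
  revPQ⁻-mapA a p = app-map (names (PQ k †Q)) (λ a → k ∸ suc a) a p

  revPQ-iso : Iso (PQS k) (PQS k †S)
  revPQ-iso = mkIso (revPQ k) (revPQ⁻ k) back-forthV back-forthA forth-backV forth-backA
    where
    back-forthV : ∀ v → v ∈ V (PQ k) → mapV (revPQ⁻ k) (mapV (revPQ k) v) ≡ v
    back-forthV v p rewrite revPQ-mapV v p =
      trans (revPQ⁻-mapV _ (∈VPQ⁺ (m∸n≤m k v))) (m∸[m∸n]≡n (∈VPQ p))
    back-forthA : ∀ a → a ∈ names (PQ k) → mapA (revPQ⁻ k) (mapA (revPQ k) a) ≡ a
    back-forthA a p rewrite revPQ-mapA a p =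
      trans (revPQ⁻-mapA _ (∈namesPQ†⁺ (m<n⇒n∸1+m<n (∈namesPQ p)))) (m<n⇒n∸1+[n∸1+m]≡m (∈namesPQ p))
    forth-backV : ∀ v → v ∈ V (PQ k) → mapV (revPQ k) (mapV (revPQ⁻ k) v) ≡ v
    forth-backV v p rewrite revPQ⁻-mapV v p =
      trans (revPQ-mapV _ (∈VPQ⁺ (m∸n≤m k v))) (m∸[m∸n]≡n (∈VPQ p))
    forth-backA : ∀ a → a ∈ names (PQ k †Q) → mapA (revPQ k) (mapA (revPQ⁻ k) a) ≡ a
    forth-backA a p rewrite revPQ⁻-mapA a p =
      trans (revPQ-mapA _ (∈namesPQ⁺ (m<n⇒n∸1+m<n (∈namesPQ† p)))) (m<n⇒n∸1+[n∸1+m]≡m (∈namesPQ† p))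

module _ (k : ℕ) where
  private
    VP = V (PQ k)
    NP = names (PQ k)

  reverseVm : List ℕ → List ℕ
  reverseVm vm = map (λ j → app VP vm (k ∸ j)) VP

  reverseAm : List ℕ → List ℕ
  reverseAm am = map (λ j → app NP am (k ∸ suc j)) NP

  reverseVm-app : ∀ vm v → v ∈ VP → app VP (reverseVm vm) v ≡ app VP vm (k ∸ v)
  reverseVm-app vm v p = app-map VP _ v p

  reverseAm-app : ∀ am a → a ∈ NP → app NP (reverseAm am) a ≡ app NP am (k ∸ suc a)
  reverseAm-app am a p = app-map NP _ a p

  reverse-isMorphism : (X Y : Quiver) → (∀ v → v ∈ V X → v ∈ V Y) →
    (∀ a s t → (a , s , t) ∈ A X → (a , t , s) ∈ A Y) →
    ∀ vm am → IsMorphism (PQ k) X vm am → IsMorphism (PQ k) Y (reverseVm vm) (reverseAm am)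
  reverse-isMorphism X Y hV hA vm am (_ , _ , mapV∈ , mapArr∈) =
    length-map _ VP , trans (length-map _ NP) (length-map name (A (PQ k))) , vert , arr
    where
    f = app VP vm
    g = app NP am
    vert : ∀ v → v ∈ VP → app VP (reverseVm vm) v ∈ V Y
    vert v p = subst (_∈ V Y) (sym (reverseVm-app vm v p)) (hV _ (mapV∈ (k ∸ v) (∈VPQ⁺ (m∸n≤m k v))))
    arr : ∀ a s t → (a , s , t) ∈ A (PQ k) →
          (app NP (reverseAm am) a , app VP (reverseVm vm) s , app VP (reverseVm vm) t) ∈ A Y
    arr a s t p with ∈pqA {k} p
    ... | a<k , refl , refl
      rewrite reverseAm-app am a (∈namesPQ⁺ a<k)
            | reverseVm-app vm a (∈VPQ⁺ (<⇒≤ a<k))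
            | reverseVm-app vm (suc a) (∈VPQ⁺ a<k) =
      hA _ _ _ (subst (λ z → (g (k ∸ suc a) , f (k ∸ suc a) , f z) ∈ A X) (m<n⇒1+[n∸1+m]≡n∸m a<k)
                 (mapArr∈ (k ∸ suc a) (k ∸ suc a) (suc (k ∸ suc a)) (∈-map⁺ pqArr (∈-upTo⁺ (m<n⇒n∸1+m<n a<k)))))

reverseBPair : ∀ {Q Q' : Sort} → (∀ v → v ∈ V (quiver Q) → v ∈ V (quiver Q')) →
  (∀ a s t → (a , s , t) ∈ A (quiver Q) → (a , t , s) ∈ A (quiver Q')) → BPair Q → BPair Q'
reverseBPair {Q} {Q'} hV hA b = record
  { k₁ = k₁ ; k₂ = k₂
  ; vm₁ = reverseVm k₁ vm₁ ; am₁ = reverseAm k₁ am₁ ; vm₂ = reverseVm k₂ vm₂ ; am₂ = reverseAm k₂ am₂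
  ; path₁ = reverse-isMorphism k₁ (quiver Q) (quiver Q') hV hA vm₁ am₁ path₁
  ; path₂ = reverse-isMorphism k₂ (quiver Q) (quiver Q') hV hA vm₂ am₂ path₂
  ; sameStart = trans (reverseVm-app k₁ vm₁ 0 (∈VPQ⁺ z≤n)) (trans sameEnd (sym (reverseVm-app k₂ vm₂ 0 (∈VPQ⁺ z≤n))))
  ; sameEnd = trans (endpoint k₁ vm₁) (trans sameStart (sym (endpoint k₂ vm₂))) }
  where
  open BPair b
  endpoint : ∀ k vm → app (V (PQ k)) (reverseVm k vm) k ≡ app (V (PQ k)) vm 0
  endpoint k vm = trans (reverseVm-app k vm k (∈VPQ⁺ ≤-refl)) (cong (app (V (PQ k)) vm) (n∸n≡0 k))

-- q is the path of Q† obtained by reading the path (vm, am) of Q backwards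
reversePath-isComp : ∀ (Q : Sort) k vm am (pm : IsMorphism (PQ k) (quiver Q) vm am) (q : Emb (PQS k) (Q †S)) →
  (∀ v → v ∈ V (PQ k) → app (V (PQ k)) vm (k ∸ v) ≡ mapV q v) →
  (∀ a → a ∈ names (PQ k) → app (names (PQ k)) am (k ∸ suc a) ≡ mapA q a) →
  IsComp (revPQ k) (pathEmb Q k vm am pm †E) q
reversePath-isComp (mkS Qq ac) k vm am pm q hv ha =
  (λ v p → sym (trans (cong (app (V (PQ k)) vm) (revPQ-mapV k v p)) (hv v p))) ,
  (λ a p → sym (trans (mapA-† (pathEmb (mkS Qq ac) k vm am pm) _)
                 (trans (cong (app (names (PQ k)) am) (revPQ-mapA k a p)) (ha a p))))

reverse-isMorphism⁺ : ∀ (Q : Sort) k vm am → IsMorphism (PQ k) (quiver Q) vm am →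
  IsMorphism (PQ k) (quiver (Q †S)) (reverseVm k vm) (reverseAm k am)
reverse-isMorphism⁺ Q k = reverse-isMorphism k (quiver Q) (quiver (Q †S)) (λ v p → p) (λ a s t p → ∈swap⁺ p)

reverse-isMorphism⁻ : ∀ (Q : Sort) k vm am → IsMorphism (PQ k) (quiver (Q †S)) vm am →
  IsMorphism (PQ k) (quiver Q) (reverseVm k vm) (reverseAm k am)
reverse-isMorphism⁻ Q k = reverse-isMorphism k (quiver (Q †S)) (quiver Q) (λ v p → p) (λ a s t p → ∈swap⁻ p)

BPair-†⁺-isComp : ∀ (Q : Sort) k vm am (pm : IsMorphism (PQ k) (quiver Q) vm am) →
  IsComp (revPQ k) (pathEmb Q k vm am pm †E)
         (pathEmb (Q †S) k (reverseVm k vm) (reverseAm k am) (reverse-isMorphism⁺ Q k vm am pm))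
BPair-†⁺-isComp Q k vm am pm =
  reversePath-isComp Q k vm am pm (pathEmb (Q †S) k (reverseVm k vm) (reverseAm k am) (reverse-isMorphism⁺ Q k vm am pm))
    (λ v p → sym (reverseVm-app k vm v p)) (λ a p → sym (reverseAm-app k am a p))

BPair-†⁻-isComp : ∀ (Q : Sort) k vm am (pm : IsMorphism (PQ k) (quiver (Q †S)) vm am) →
  IsComp (revPQ k) (pathEmb Q k (reverseVm k vm) (reverseAm k am) (reverse-isMorphism⁻ Q k vm am pm) †E)
         (pathEmb (Q †S) k vm am pm)
BPair-†⁻-isComp Q k vm am pm =
  reversePath-isComp Q k (reverseVm k vm) (reverseAm k am) (reverse-isMorphism⁻ Q k vm am pm) (pathEmb (Q †S) k vm am pm)
    (λ v p → trans (reverseVm-app k vm (k ∸ v) (∈VPQ⁺ (m∸n≤m k v))) (cong (app (V (PQ k)) vm) (m∸[m∸n]≡n (∈VPQ p))))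
    (λ a p → trans (reverseAm-app k am (k ∸ suc a) (∈namesPQ⁺ (m<n⇒n∸1+m<n (∈namesPQ p))))
                   (cong (app (names (PQ k)) am) (m<n⇒n∸1+[n∸1+m]≡m (∈namesPQ p))))

BPair-†⁺ : ∀ {Q : Sort} → BPair Q → BPair (Q †S)
BPair-†⁺ = reverseBPair (λ v p → p) (λ a s t p → ∈swap⁺ p)

BPair-†⁻ : ∀ {Q : Sort} → BPair (Q †S) → BPair Q
BPair-†⁻ = reverseBPair (λ v p → p) (λ a s t p → ∈swap⁻ p)

module _ (k L d : ℕ) .(le : k + d ≤ L) where
  shiftE-mapV : ∀ v → v ∈ V (PQ k) → mapV (shiftE k L d le) v ≡ v + d
  shiftE-mapV v p = app-map (V (PQ k)) (_+ d) v p

  shiftE-mapA : ∀ a → a ∈ names (PQ k) → mapA (shiftE k L d le) a ≡ a + d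
  shiftE-mapA a p = app-map (names (PQ k)) (_+ d) a p

  shiftE†-mapA : ∀ a → a ∈ names (PQ k) → mapA (shiftE k L d le †E) a ≡ a + d
  shiftE†-mapA a p = trans (mapA-† (shiftE k L d le) a) (shiftE-mapA a p)

module _ (k L : ℕ) (le : k ≤ L) where
  private
    d = L ∸ k
    le-sp : k + 0 ≤ L
    le-sp = subst (_≤ L) (sym (+-identityʳ k)) le
    le-tp : k + d ≤ L
    le-tp = ≤-reflexive (m+[n∸m]≡n le)

    L∸v≡[k∸v]+d : ∀ v → v ≤ k → L ∸ v ≡ (k ∸ v) + d
    L∸v≡[k∸v]+d v v≤k = trans (cong (_∸ v) (sym (m+[n∸m]≡n le))) (+-∸-comm d v≤k)

    L∸[v+d]≡k∸v : ∀ v → L ∸ (v + d) ≡ k ∸ v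
    L∸[v+d]≡k∸v v = trans (cong (_∸ (v + d)) (sym (m+[n∸m]≡n le)))
      (trans (cong₂ _∸_ (+-comm k d) (+-comm v d)) ([m+n]∸[m+o]≡n∸o d k v))

  revPQ-spE : Square (spE k L le) (revPQ L) (revPQ k) (tpE k L le †E)
  revPQ-spE = onV , onA
    where
    onV : ∀ v → v ∈ V (PQ k) → mapV (revPQ L) (mapV (spE k L le) v) ≡ mapV (tpE k L le †E) (mapV (revPQ k) v)
    onV v p rewrite shiftE-mapV k L 0 le-sp v p | revPQ-mapV k v p | +-identityʳ v =
      trans (revPQ-mapV L v (∈VPQ⁺ (≤-trans (∈VPQ p) le)))
        (trans (L∸v≡[k∸v]+d v (∈VPQ p)) (sym (shiftE-mapV k L d le-tp (k ∸ v) (∈VPQ⁺ (m∸n≤m k v)))))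
    onA : ∀ a → a ∈ names (PQ k) → mapA (revPQ L) (mapA (spE k L le) a) ≡ mapA (tpE k L le †E) (mapA (revPQ k) a)
    onA a p rewrite shiftE-mapA k L 0 le-sp a p | revPQ-mapA k a p | +-identityʳ a =
      trans (revPQ-mapA L a (∈namesPQ⁺ (<-≤-trans (∈namesPQ p) le)))
        (trans (L∸v≡[k∸v]+d (suc a) (∈namesPQ p))
          (sym (shiftE†-mapA k L d le-tp (k ∸ suc a) (∈namesPQ⁺ (m<n⇒n∸1+m<n (∈namesPQ p))))))

  revPQ-tpE : Square (tpE k L le) (revPQ L) (revPQ k) (spE k L le †E)
  revPQ-tpE = onV , onA
    where
    onV : ∀ v → v ∈ V (PQ k) → mapV (revPQ L) (mapV (tpE k L le) v) ≡ mapV (spE k L le †E) (mapV (revPQ k) v)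
    onV v p rewrite shiftE-mapV k L d le-tp v p | revPQ-mapV k v p =
      trans (revPQ-mapV L (v + d) (∈VPQ⁺ (≤-trans (+-monoˡ-≤ d (∈VPQ p)) le-tp)))
        (trans (L∸[v+d]≡k∸v v)
          (sym (trans (shiftE-mapV k L 0 le-sp (k ∸ v) (∈VPQ⁺ (m∸n≤m k v))) (+-identityʳ _))))
    onA : ∀ a → a ∈ names (PQ k) → mapA (revPQ L) (mapA (tpE k L le) a) ≡ mapA (spE k L le †E) (mapA (revPQ k) a)
    onA a p rewrite shiftE-mapA k L d le-tp a p | revPQ-mapA k a p =
      trans (revPQ-mapA L (a + d) (∈namesPQ⁺ (≤-trans (+-monoˡ-≤ d (∈namesPQ p)) le-tp)))
        (trans (L∸[v+d]≡k∸v (suc a))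
          (sym (trans (shiftE†-mapA k L 0 le-sp (k ∸ suc a) (∈namesPQ⁺ (m<n⇒n∸1+m<n (∈namesPQ p))))
                      (+-identityʳ _))))

module _ {P : ℕ → Set} where
  on0 : P 0 → ∀ v → v ∈ 0 ∷ [] → P v
  on0 p .0 (here refl) = p

  on01 : P 0 → P 1 → ∀ v → v ∈ 0 ∷ 1 ∷ [] → P v
  on01 p q .0 (here refl) = p
  on01 p q .1 (there (here refl)) = q

  on012 : P 0 → P 1 → P 2 → ∀ v → v ∈ 0 ∷ 1 ∷ 2 ∷ [] → P v
  on012 p q r .0 (here refl) = p
  on012 p q r .1 (there (here refl)) = q
  on012 p q r .2 (there (there (here refl))) = r

swapD₂ : Emb D₂ D₂
swapD₂ = mkEmbD D₂ D₂ (1 ∷ 0 ∷ []) []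

swapD₂-iso : Iso D₂ D₂
swapD₂-iso = mkIso swapD₂ swapD₂ (on01 refl refl) (λ a ()) (on01 refl refl) (λ a ())

revPQ-stE : ∀ n → Square (stE n) (revPQ (suc n)) swapD₂ (stE n †E)
revPQ-stE n = on01 refl (trans (revPQ-mapV (suc n) (suc n) (∈VPQ⁺ ≤-refl)) (n∸n≡0 (suc n))) , λ a ()

pt₀ pt₁ : Emb (PQS 0) D₂
pt₀ = mkEmbD (PQS 0) D₂ (0 ∷ []) []
pt₁ = mkEmbD (PQS 0) D₂ (1 ∷ []) []

stE-pt₀ : IsComp pt₀ (stE 0) σE
stE-pt₀ = on0 refl , λ a ()

stE-pt₁ : IsComp pt₁ (stE 0) τE
stE-pt₁ = on0 refl , λ a ()

revPQ-σE : IsComp σE (revPQ 1) (τE †E)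
revPQ-σE = on0 refl , λ a ()

revPQ-τE : IsComp τE (revPQ 1) (σE †E)
revPQ-τE = on0 refl , λ a ()

e₀₂-σE : Square σE e₀₂ σE e₀₁
e₀₂-σE = on0 refl , λ a ()

e₀₂-τE : Square τE e₀₂ τE e₁₂
e₀₂-τE = on0 refl , λ a ()

revT : Emb TS (TS †S)
revT = mkEmbD TS (TS †S) (2 ∷ 1 ∷ 0 ∷ []) (2 ∷ 1 ∷ 0 ∷ [])

revT⁻ : Emb (TS †S) TS
revT⁻ = mkEmbD (TS †S) TS (2 ∷ 1 ∷ 0 ∷ []) (2 ∷ 1 ∷ 0 ∷ [])

revT-iso : Iso TS (TS †S)
revT-iso = mkIso revT revT⁻ (on012 refl refl refl) (on012 refl refl refl) (on012 refl refl refl) (on012 refl refl refl)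

revT-e₀₁ : Square e₀₁ revT (revPQ 1) (e₁₂ †E)
revT-e₀₁ = on01 refl refl , on0 refl

revT-e₁₂ : Square e₁₂ revT (revPQ 1) (e₀₁ †E)
revT-e₁₂ = on01 refl refl , on0 refl

revT-e₀₂ : Square e₀₂ revT (revPQ 1) (e₀₂ †E)
revT-e₀₂ = on01 refl refl , on0 refl

revC₂ : Emb C₂ (C₂ †S)
revC₂ = mkEmbD C₂ (C₂ †S) (1 ∷ 0 ∷ []) (0 ∷ 1 ∷ [])

revC₂-a₀E : Square a₀E revC₂ (revPQ 1) (a₀E †E)
revC₂-a₀E = on01 refl refl , on0 refl

revC₂-a₁E : Square a₁E revC₂ (revPQ 1) (a₁E †E)
revC₂-a₁E = on01 refl refl , on0 refl

if-T : ∀ {A : Set} {b : Bool} {x y : A} → T b → (if b then x else y) ≡ x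
if-T {b = true} _ = refl

if-¬T : ∀ {A : Set} {b : Bool} {x y : A} → ¬ T b → (if b then x else y) ≡ y
if-¬T {b = false} _ = refl
if-¬T {b = true} ¬t = ⊥-elim (¬t tt)

module BigonReversal (n₁ n₂ : ℕ) where
  open Bigon n₁ n₂

  -- Both paths of the bigon are reversed: the vertex i of the first path
  -- goes to k₁ ∸ i, the vertex j of the second path to its vertex k₂ ∸ j.
  revV : ℕ → ℕ
  revV v = if v ≤ᵇ k₁ then k₁ ∸ v else k₁ + (k₂ ∸ (v ∸ k₁))

  revA : ℕ → ℕ
  revA a = if a <ᵇ k₁ then k₁ ∸ suc a else k₁ + (k₂ ∸ suc (a ∸ k₁))

  revV-path₁ : ∀ {v} → v ≤ k₁ → revV v ≡ k₁ ∸ v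
  revV-path₁ p = if-T (≤⇒≤ᵇ p)

  revV-path₂ : ∀ {j} → 0 < j → revV (k₁ + j) ≡ k₁ + (k₂ ∸ j)
  revV-path₂ {j} 0<j = trans (if-¬T (λ t → <⇒≱ (m<m+n k₁ 0<j) (≤ᵇ⇒≤ _ _ t)))
                             (cong (λ i → k₁ + (k₂ ∸ i)) (m+n∸m≡n k₁ j))

  revA-path₁ : ∀ {a} → a < k₁ → revA a ≡ k₁ ∸ suc a
  revA-path₁ p = if-T (<⇒<ᵇ p)

  revA-path₂ : ∀ j → revA (k₁ + j) ≡ k₁ + (k₂ ∸ suc j)
  revA-path₂ j = trans (if-¬T (λ t → <⇒≱ (<ᵇ⇒< _ _ t) (m≤m+n k₁ j)))
                       (cong (λ i → k₁ + (k₂ ∸ suc i)) (m+n∸m≡n k₁ j))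

  data VertexView (v : ℕ) : Set where
    path₁ : v ≤ k₁ → VertexView v
    path₂ : ∀ j → 0 < j → j < k₂ → v ≡ k₁ + j → VertexView v

  vertexView : ∀ v → v ≤ k₁ + n₂ → VertexView v
  vertexView v p with v ≤? k₁
  ... | yes v≤k₁ = path₁ v≤k₁
  ... | no v≰k₁ = path₂ (v ∸ k₁) (m<n⇒0<n∸m k₁<v) (s≤s (m≤n+o⇒m∸n≤o v k₁ p)) (sym (m+[n∸m]≡n (<⇒≤ k₁<v)))
    where k₁<v = ≰⇒> v≰k₁

  data ArrowView (a : ℕ) : Set where
    path₁ : a < k₁ → ArrowView a
    path₂ : ∀ j → j < k₂ → a ≡ k₁ + j → ArrowView a

  arrowView : ∀ a → a < k₁ + k₂ → ArrowView a
  arrowView a p with a <? k₁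
  ... | yes a<k₁ = path₁ a<k₁
  ... | no a≮k₁ = path₂ (a ∸ k₁) (subst (a ∸ k₁ <_) (m+n∸m≡n k₁ k₂) (∸-monoˡ-< p (≮⇒≥ a≮k₁)))
                        (sym (m+[n∸m]≡n (≮⇒≥ a≮k₁)))

  revV-≤ : ∀ v → v ≤ k₁ + n₂ → revV v ≤ k₁ + n₂
  revV-≤ v p with vertexView v p
  ... | path₁ q rewrite revV-path₁ q = ≤-trans (m∸n≤m k₁ v) (m≤m+n k₁ n₂)
  ... | path₂ j 0<j _ refl rewrite revV-path₂ 0<j = +-monoʳ-≤ k₁ (∸-monoʳ-≤ k₂ 0<j)

  revV-involutive : ∀ v → v ≤ k₁ + n₂ → revV (revV v) ≡ v
  revV-involutive v p with vertexView v p
  ... | path₁ q rewrite revV-path₁ q | revV-path₁ (m∸n≤m k₁ v) = m∸[m∸n]≡n q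
  ... | path₂ j 0<j j<k₂ refl rewrite revV-path₂ 0<j | revV-path₂ (m<n⇒0<n∸m j<k₂) =
    cong (k₁ +_) (m∸[m∸n]≡n (<⇒≤ j<k₂))

  revA-< : ∀ a → a < k₁ + k₂ → revA a < k₁ + k₂
  revA-< a p with arrowView a p
  ... | path₁ q rewrite revA-path₁ q = <-≤-trans (m<n⇒n∸1+m<n q) (m≤m+n k₁ k₂)
  ... | path₂ j q refl rewrite revA-path₂ j = +-monoʳ-< k₁ (m<n⇒n∸1+m<n q)

  revA-involutive : ∀ a → a < k₁ + k₂ → revA (revA a) ≡ a
  revA-involutive a p with arrowView a p
  ... | path₁ q rewrite revA-path₁ q | revA-path₁ (m<n⇒n∸1+m<n q) = m<n⇒n∸1+[n∸1+m]≡m q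
  ... | path₂ j q refl rewrite revA-path₂ j | revA-path₂ (k₂ ∸ suc j) = cong (k₁ +_) (m<n⇒n∸1+[n∸1+m]≡m q)

  v₂-end : v₂ k₂ ≡ k₁
  v₂-end = if-T (≡⇒≡ᵇ n₂ n₂ refl)

  v₂-mid : ∀ {j} → 0 < j → j < k₂ → v₂ j ≡ k₁ + j
  v₂-mid {suc i} _ j<k₂ = if-¬T (λ t → <-irrefl (≡ᵇ⇒≡ _ _ t) j<k₂)

  revV-v₂ : ∀ j → j ≤ k₂ → revV (v₂ j) ≡ v₂ (k₂ ∸ j)
  revV-v₂ zero _ = trans (revV-path₁ z≤n) (sym v₂-end)
  revV-v₂ (suc i) p with m≤n⇒m<n∨m≡n p
  ... | inj₂ refl =
    trans (cong revV v₂-end) (trans (revV-path₁ ≤-refl) (trans (n∸n≡0 k₁) (cong v₂ (sym (n∸n≡0 k₂)))))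
  ... | inj₁ q rewrite v₂-mid (s≤s z≤n) q | revV-path₂ {suc i} (s≤s z≤n) =
    sym (v₂-mid (m<n⇒0<n∸m q) (m<n⇒n∸1+m<n (<⇒≤ q)))

  bArr-path₁ : ∀ {a} → a < k₁ → bArr a ≡ (a , a , suc a)
  bArr-path₁ p = if-T (<⇒<ᵇ p)

  bArr-path₂ : ∀ j → bArr (k₁ + j) ≡ (k₁ + j , v₂ j , v₂ (suc j))
  bArr-path₂ j = trans (if-¬T (λ t → <⇒≱ (<ᵇ⇒< _ _ t) (m≤m+n k₁ j)))
                       (cong (λ i → (k₁ + j , v₂ i , v₂ (suc i))) (m+n∸m≡n k₁ j))

  bArr-revA : ∀ a → a < k₁ + k₂ → bArr (revA a) ≡ (revA a , revV (tgt (bArr a)) , revV (src (bArr a)))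
  bArr-revA a p with arrowView a p
  ... | path₁ q rewrite bArr-path₁ q | revA-path₁ q | bArr-path₁ (m<n⇒n∸1+m<n q)
                      | revV-path₁ q | revV-path₁ (<⇒≤ q) =
    cong (λ z → (k₁ ∸ suc a , k₁ ∸ suc a , z)) (m<n⇒1+[n∸1+m]≡n∸m q)
  ... | path₂ j q refl rewrite bArr-path₂ j | revA-path₂ j | bArr-path₂ (k₂ ∸ suc j)
                             | revV-v₂ (suc j) q | revV-v₂ j (<⇒≤ q) =
    cong (λ z → (k₁ + (k₂ ∸ suc j) , v₂ (k₂ ∸ suc j) , v₂ z)) (m<n⇒1+[n∸1+m]≡n∸m q)

  name-bArr : ∀ b → name (bArr b) ≡ b
  name-bArr b with b <ᵇ k₁
  ... | true = refl
  ... | false = refl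

  ∈BA : ∀ {a s t} → (a , s , t) ∈ BA → a < k₁ + k₂ × bArr a ≡ (a , s , t)
  ∈BA p with ∈-map⁻ bArr p
  ... | b , b∈ , e = subst (_< k₁ + k₂) b≡a (∈-upTo⁻ b∈) , subst (λ z → bArr z ≡ _) b≡a (sym e)
    where b≡a = trans (sym (name-bArr b)) (sym (cong name e))

  ∈BA⁺ : ∀ a → a < k₁ + k₂ → bArr a ∈ BA
  ∈BA⁺ a p = ∈-map⁺ bArr (∈-upTo⁺ p)

  ∈namesB : ∀ {a} → a ∈ names BQ → a < k₁ + k₂
  ∈namesB p with ∈-map⁻ name p
  ... | (a , s , t) , q , refl = proj₁ (∈BA q)

  ∈namesB⁺ : ∀ {a} → a < k₁ + k₂ → a ∈ names BQ
  ∈namesB⁺ {a} p = subst (_∈ names BQ) (name-bArr a) (∈-map⁺ name (∈BA⁺ a p))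

  ∈namesB† : ∀ {a} → a ∈ names (BQ †Q) → a < k₁ + k₂
  ∈namesB† p = ∈namesB (names-†⁻ {BS} p)

  ∈namesB†⁺ : ∀ {a} → a < k₁ + k₂ → a ∈ names (BQ †Q)
  ∈namesB†⁺ p = names-†⁺ {BS} (∈namesB⁺ p)

  ∈BV : ∀ {v} → v ∈ BV → v ≤ k₁ + n₂
  ∈BV p = ≤-pred (∈-upTo⁻ p)

  ∈BV⁺ : ∀ {v} → v ≤ k₁ + n₂ → v ∈ BV
  ∈BV⁺ p = ∈-upTo⁺ (s≤s p)

  reversed-∈BA : ∀ a s t → (a , s , t) ∈ BA → (revA a , revV t , revV s) ∈ BA
  reversed-∈BA a s t p with ∈BA p
  ... | a< , e = subst (_∈ BA) (trans (bArr-revA a a<) (cong (λ z → (revA a , revV (tgt z) , revV (src z))) e))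
                       (∈BA⁺ (revA a) (revA-< a a<))

  revB : Emb BS (BS †S)
  revB = mkEmbF BS (BS †S) revV revA (λ v p → ∈BV⁺ (revV-≤ v (∈BV p)))
    (λ a s t p → ∈swap⁺ (reversed-∈BA a s t p))
    (λ x y p q e → trans (sym (revV-involutive x (∈BV p))) (trans (cong revV e) (revV-involutive y (∈BV q))))
    (λ x y p q e → trans (sym (revA-involutive x (∈namesB p))) (trans (cong revA e) (revA-involutive y (∈namesB q))))

  revB⁻ : Emb (BS †S) BS
  revB⁻ = mkEmbF (BS †S) BS revV revA (λ v p → ∈BV⁺ (revV-≤ v (∈BV p)))
    (λ a s t p → reversed-∈BA a t s (∈swap⁻ p))
    (λ x y p q e → trans (sym (revV-involutive x (∈BV p))) (trans (cong revV e) (revV-involutive y (∈BV q))))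
    (λ x y p q e → trans (sym (revA-involutive x (∈namesB† p))) (trans (cong revA e) (revA-involutive y (∈namesB† q))))

  revB-mapV : ∀ v → v ∈ BV → mapV revB v ≡ revV v
  revB-mapV v p = app-map BV revV v p

  revB-mapA : ∀ a → a ∈ names BQ → mapA revB a ≡ revA a
  revB-mapA a p = app-map (names BQ) revA a p

  revB⁻-mapV : ∀ v → v ∈ BV → mapV revB⁻ v ≡ revV v
  revB⁻-mapV v p = app-map BV revV v p

  revB⁻-mapA : ∀ a → a ∈ names (BQ †Q) → mapA revB⁻ a ≡ revA a
  revB⁻-mapA a p = app-map (names (BQ †Q)) revA a p

  revB-iso : Iso BS (BS †S)
  revB-iso = mkIso revB revB⁻ back-forthV back-forthA forth-backV forth-backA
    where
    back-forthV : ∀ v → v ∈ BV → mapV revB⁻ (mapV revB v) ≡ v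
    back-forthV v p rewrite revB-mapV v p = trans (revB⁻-mapV _ (∈BV⁺ (revV-≤ v (∈BV p)))) (revV-involutive v (∈BV p))
    back-forthA : ∀ a → a ∈ names BQ → mapA revB⁻ (mapA revB a) ≡ a
    back-forthA a p rewrite revB-mapA a p =
      trans (revB⁻-mapA _ (∈namesB†⁺ (revA-< a (∈namesB p)))) (revA-involutive a (∈namesB p))
    forth-backV : ∀ v → v ∈ BV → mapV revB (mapV revB⁻ v) ≡ v
    forth-backV v p rewrite revB⁻-mapV v p = trans (revB-mapV _ (∈BV⁺ (revV-≤ v (∈BV p)))) (revV-involutive v (∈BV p))
    forth-backA : ∀ a → a ∈ names (BQ †Q) → mapA revB (mapA revB⁻ a) ≡ a
    forth-backA a p rewrite revB⁻-mapA a p =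
      trans (revB-mapA _ (∈namesB⁺ (revA-< a (∈namesB† p)))) (revA-involutive a (∈namesB† p))

  revB-m₁'E : Square m₁'E revB (revPQ k₁) (m₁'E †E)
  revB-m₁'E = onV , onA
    where
    P₁ = PQ k₁
    onV : ∀ v → v ∈ V P₁ → mapV revB (mapV m₁'E v) ≡ mapV (m₁'E †E) (mapV (revPQ k₁) v)
    onV v p rewrite app-self (V P₁) v p | revPQ-mapV k₁ v p =
      trans (revB-mapV v (∈BV⁺ (≤-trans (∈VPQ p) (m≤m+n k₁ n₂))))
        (trans (revV-path₁ (∈VPQ p)) (sym (app-self (V P₁) (k₁ ∸ v) (∈VPQ⁺ (m∸n≤m k₁ v)))))
    onA : ∀ a → a ∈ names P₁ → mapA revB (mapA m₁'E a) ≡ mapA (m₁'E †E) (mapA (revPQ k₁) a)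
    onA a p rewrite app-self (names P₁) a p | revPQ-mapA k₁ a p =
      trans (revB-mapA a (∈namesB⁺ (<-≤-trans (∈namesPQ p) (m≤m+n k₁ k₂))))
        (trans (revA-path₁ (∈namesPQ p))
          (sym (trans (mapA-† m₁'E (k₁ ∸ suc a))
                      (app-self (names P₁) (k₁ ∸ suc a) (∈namesPQ⁺ (m<n⇒n∸1+m<n (∈namesPQ p)))))))

  revB-m₂'E : Square m₂'E revB (revPQ k₂) (m₂'E †E)
  revB-m₂'E = onV , onA
    where
    P₂ = PQ k₂
    onV : ∀ v → v ∈ V P₂ → mapV revB (mapV m₂'E v) ≡ mapV (m₂'E †E) (mapV (revPQ k₂) v)
    onV v p = begin
      mapV revB (mapV m₂'E v)                 ≡⟨ revB-mapV _ (mapV-∈ m₂'E v p) ⟩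
      revV (mapV m₂'E v)                      ≡⟨ cong revV (app-map (V P₂) v₂ v p) ⟩
      revV (v₂ v)                             ≡⟨ revV-v₂ v (∈VPQ p) ⟩
      v₂ (k₂ ∸ v)                             ≡⟨ app-map (V P₂) v₂ (k₂ ∸ v) (∈VPQ⁺ (m∸n≤m k₂ v)) ⟨
      mapV (m₂'E †E) (k₂ ∸ v)                 ≡⟨ cong (mapV (m₂'E †E)) (revPQ-mapV k₂ v p) ⟨
      mapV (m₂'E †E) (mapV (revPQ k₂) v)      ∎
      where open ≡-Reasoning
    onA : ∀ a → a ∈ names P₂ → mapA revB (mapA m₂'E a) ≡ mapA (m₂'E †E) (mapA (revPQ k₂) a)
    onA a p rewrite app-map (names P₂) (k₁ +_) a p | revPQ-mapA k₂ a p =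
      trans (revB-mapA _ (∈namesB⁺ (+-monoʳ-< k₁ (∈namesPQ p))))
        (trans (revA-path₂ a)
          (sym (trans (mapA-† m₂'E (k₂ ∸ suc a))
                      (app-map (names P₂) (k₁ +_) (k₂ ∸ suc a) (∈namesPQ⁺ (m<n⇒n∸1+m<n (∈namesPQ p)))))))

BPair-map : ∀ {Q Q'} (e : Emb Q Q') → BPair Q → BPair Q'
BPair-map e b = record
  { k₁ = k₁ ; k₂ = k₂ ; vm₁ = map (mapV e) vm₁ ; am₁ = map (mapA e) am₁
  ; vm₂ = map (mapV e) vm₂ ; am₂ = map (mapA e) am₂
  ; path₁ = ∘-isMorphism (PQS k₁) {vm = vm₁} {am₁} path₁ e ; path₂ = ∘-isMorphism (PQS k₂) {vm = vm₂} {am₂} path₂ e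
  ; sameStart = pushed vm₁ vm₂ (proj₁ path₁) (proj₁ path₂) (∈VPQ⁺ z≤n) (∈VPQ⁺ z≤n) sameStart
  ; sameEnd = pushed vm₁ vm₂ (proj₁ path₁) (proj₁ path₂) (∈VPQ⁺ ≤-refl) (∈VPQ⁺ ≤-refl) sameEnd }
  where
  open BPair b
  pushed : ∀ {l₁ l₂} vm vm' {i j} → length vm ≡ length (V (PQ l₁)) → length vm' ≡ length (V (PQ l₂)) →
           i ∈ V (PQ l₁) → j ∈ V (PQ l₂) → app (V (PQ l₁)) vm i ≡ app (V (PQ l₂)) vm' j →
           app (V (PQ l₁)) (map (mapV e) vm) i ≡ app (V (PQ l₂)) (map (mapV e) vm') j
  pushed vm vm' len len' p p' eq =
    trans (app-∘ _ vm _ _ len p) (trans (cong (mapV e) eq) (sym (app-∘ _ vm' _ _ len' p')))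

pathEmb-isComp : ∀ {Q Q'} (e : Emb Q Q') k vm am (pm : IsMorphism (PQ k) (quiver Q) vm am) →
  IsComp (pathEmb Q k vm am pm) e (pathEmb Q' k (map (mapV e) vm) (map (mapA e) am) (∘-isMorphism (PQS k) {vm = vm} {am} pm e))
pathEmb-isComp {mkS _ _} {mkS _ _} e k vm am pm =
  (λ v p → app-∘ (V (PQ k)) vm (mapV e) v (proj₁ pm) p) ,
  (λ a p → app-∘ (names (PQ k)) am (mapA e) a (trans (proj₁ (proj₂ pm)) (sym (length-map name (A (PQ k))))) p)

module CatModel (𝓜 : Structure) (ax : 𝓜 ⊨Th 𝒯cat) where
  open Semantics 𝓜

  M : Sort → Set
  M = Carrier 𝓜

  res : ∀ {Q Q'} → Emb Q' Q → M Q → M Q'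
  res = restrᴹ 𝓜

  com : (Q : Sort) → M Q → Set
  com = commuteᴹ 𝓜

  restr-comp : ∀ {Q Q' Q''} {m : Emb Q'' Q'} {m' : Emb Q' Q} {n : Emb Q'' Q} → IsComp m m' n →
               ∀ x → res m (res m' x) ≡ res n x
  restr-comp {m = m} {m'} {n} c = ax _ (restrComp m m' n c)

  -- In the pushout of identities, x and res id x both fill the cospan (x, x), hence coincide.
  restr-id : ∀ Q x → res (idEmb Q) x ≡ x
  restr-id Q x with ax _ (pushoutEU (identityPushout Q)) x x refl
  ... | x' , (x'↦x , _) , unique = trans (cong (res i) x≡x') x'↦x
    where
    i = idEmb Q
    fixed : res i x' ≡ x'
    fixed = unique (res i x') (trans (restr-comp (idEmb-isComp Q) x') x'↦x , trans (restr-comp (idEmb-isComp Q) x') x'↦x)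
    x≡x' : x ≡ x'
    x≡x' = trans (sym x'↦x) fixed

  restr-ext : ∀ {Q Q'} (e e' : Emb Q' Q) →
    (∀ v → v ∈ V (quiver Q') → mapV e v ≡ mapV e' v) →
    (∀ a → a ∈ names (quiver Q') → mapA e a ≡ mapA e' a) → ∀ x → res e x ≡ res e' x
  restr-ext {Q} e e' sameV sameA x =
    trans (cong (res e) (sym (restr-id Q x)))
      (restr-comp ((λ v p → trans (sym (sameV v p)) (sym (idEmb-mapV Q _ (mapV-∈ e v p)))) ,
                   (λ a p → trans (sym (sameA a p)) (sym (idEmb-mapA Q _ (mapA-∈ e a p))))) x)

  restr-square : ∀ {QA QB QC QD} {e₁ : Emb QA QB} {f₁ : Emb QB QC} {e₂ : Emb QA QD} {f₂ : Emb QD QC} →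
    Square e₁ f₁ e₂ f₂ → ∀ x → res e₁ (res f₁ x) ≡ res e₂ (res f₂ x)
  restr-square {e₁ = e₁} {f₁} {e₂} {f₂} (sqV , sqA) x =
    trans (restr-comp (∘E-isComp e₁ f₁) x)
      (trans (restr-ext (f₁ ∘E e₁) (f₂ ∘E e₂)
                (λ v p → trans (proj₁ (∘E-isComp e₁ f₁) v p) (trans (sqV v p) (sym (proj₁ (∘E-isComp e₂ f₂) v p))))
                (λ a p → trans (proj₂ (∘E-isComp e₁ f₁) a p) (trans (sqA a p) (sym (proj₂ (∘E-isComp e₂ f₂) a p)))) x)
        (sym (restr-comp (∘E-isComp e₂ f₂) x)))

  module IsoAction {Q Q'} (I : Iso Q Q') where
    open Iso I

    res-fwd-bwd : ∀ x → res fwd (res bwd x) ≡ x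
    res-fwd-bwd x = trans (restr-comp bwd∘fwd x) (restr-id Q x)

    res-bwd-fwd : ∀ y → res bwd (res fwd y) ≡ y
    res-bwd-fwd y = trans (restr-comp fwd∘bwd y) (restr-id Q' y)

    res-fwd-injective : ∀ {y y'} → res fwd y ≡ res fwd y' → y ≡ y'
    res-fwd-injective {y} {y'} e = trans (sym (res-bwd-fwd y)) (trans (cong (res bwd) e) (res-bwd-fwd y'))

  EqPathᴹ : ∀ k₁ k₂ → M (PQS k₁) → M (PQS k₂) → Set
  EqPathᴹ k₁ k₂ a b = ⟦ EqPath k₁ k₂ (var (there here)) (var here) ⟧F (b ∷ a ∷ [])

  EqPath†ᴹ : ∀ k₁ k₂ → M (PQS k₁ †S) → M (PQS k₂ †S) → Set
  EqPath†ᴹ k₁ k₂ a b = ⟦ EqPath k₁ k₂ (var (there here)) (var here) †F ⟧F (b ∷ a ∷ [])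

  -- EqPath is defined by cases on the lengths, so these unfoldings need the same case split.
  ⟦EqPath⟧-var : ∀ {Γ} k₁ k₂ (x : Γ ∋ PQS k₁) (y : Γ ∋ PQS k₂) ρ →
    ⟦ EqPath k₁ k₂ (var x) (var y) ⟧F ρ ⇔ EqPathᴹ k₁ k₂ (lookupEnv ρ x) (lookupEnv ρ y)
  ⟦EqPath⟧-var zero zero x y ρ = mk⇔ id id
  ⟦EqPath⟧-var zero (suc k₂) x y ρ = mk⇔ id id
  ⟦EqPath⟧-var (suc k₁) zero x y ρ = mk⇔ id id
  ⟦EqPath⟧-var (suc k₁) (suc k₂) x y ρ = mk⇔ id id

  ⟦EqPath†⟧-var : ∀ {Γ} k₁ k₂ (x : Γ ∋ PQS k₁) (y : Γ ∋ PQS k₂) ρ →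
    ⟦ EqPath k₁ k₂ (var x) (var y) †F ⟧F ρ ⇔ EqPath†ᴹ k₁ k₂ (lookupEnv ρ (†var x)) (lookupEnv ρ (†var y))
  ⟦EqPath†⟧-var zero zero x y ρ = mk⇔ id id
  ⟦EqPath†⟧-var zero (suc k₂) x y ρ = mk⇔ id id
  ⟦EqPath†⟧-var (suc k₁) zero x y ρ = mk⇔ id id
  ⟦EqPath†⟧-var (suc k₁) (suc k₂) x y ρ = mk⇔ id id

  ⟦EqPath⟧-restr : ∀ {Q} k₁ k₂ (p : Emb (PQS k₁) Q) (q : Emb (PQS k₂) Q) x →
    ⟦ EqPath k₁ k₂ (restr p (var here)) (restr q (var here)) ⟧F (x ∷ []) ⇔ EqPathᴹ k₁ k₂ (res p x) (res q x)
  ⟦EqPath⟧-restr zero zero p q x = mk⇔ id id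
  ⟦EqPath⟧-restr zero (suc k₂) p q x = mk⇔ id id
  ⟦EqPath⟧-restr (suc k₁) zero p q x = mk⇔ id id
  ⟦EqPath⟧-restr (suc k₁) (suc k₂) p q x = mk⇔ id id

  ⟦EqPath†⟧-restr : ∀ {Q} k₁ k₂ (p : Emb (PQS k₁) Q) (q : Emb (PQS k₂) Q) x →
    ⟦ EqPath k₁ k₂ (restr p (var here)) (restr q (var here)) †F ⟧F (x ∷ []) ⇔
    EqPath†ᴹ k₁ k₂ (res (p †E) x) (res (q †E) x)
  ⟦EqPath†⟧-restr zero zero p q x = mk⇔ id id
  ⟦EqPath†⟧-restr zero (suc k₂) p q x = mk⇔ id id
  ⟦EqPath†⟧-restr (suc k₁) zero p q x = mk⇔ id id
  ⟦EqPath†⟧-restr (suc k₁) (suc k₂) p q x = mk⇔ id id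

  path₁ᴱ : ∀ {Q} (b : BPair Q) → Emb (PQS (BPair.k₁ b)) Q
  path₁ᴱ {Q} b = pathEmb Q (BPair.k₁ b) (BPair.vm₁ b) (BPair.am₁ b) (BPair.path₁ b)

  path₂ᴱ : ∀ {Q} (b : BPair Q) → Emb (PQS (BPair.k₂ b)) Q
  path₂ᴱ {Q} b = pathEmb Q (BPair.k₂ b) (BPair.vm₂ b) (BPair.am₂ b) (BPair.path₂ b)

  commute⇔pathsEqual : ∀ Q x → ((b : BPair Q) → EqPathᴹ _ _ (res (path₁ᴱ b) x) (res (path₂ᴱ b) x)) ⇔ com Q x
  commute⇔pathsEqual Q x = mk⇔
    (λ h → proj₁ (ax _ (pathCom Q) x) (λ b → from (⟦EqPath⟧-restr _ _ (path₁ᴱ b) (path₂ᴱ b) x) (h b)))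
    (λ c b → to (⟦EqPath⟧-restr _ _ (path₁ᴱ b) (path₂ᴱ b) x) (proj₂ (ax _ (pathCom Q) x) c b))

  commute-restr : ∀ {Q Q'} (e : Emb Q Q') x → com Q' x → com Q (res e x)
  commute-restr {Q} {Q'} e x c = to (commute⇔pathsEqual Q (res e x)) λ b →
    let open BPair b in
    subst₂ (EqPathᴹ k₁ k₂) (sym (restr-comp (pathEmb-isComp e k₁ vm₁ am₁ path₁) x))
                           (sym (restr-comp (pathEmb-isComp e k₂ vm₂ am₂ path₂) x))
      (from (commute⇔pathsEqual Q' x) c (BPair-map e b))

  Compᴹ : M (PQS 1) → M (PQS 1) → M (PQS 1) → Set
  Compᴹ x y z = Σ (M TS) λ w → res e₀₁ w ≡ x × res e₁₂ w ≡ y × res e₀₂ w ≡ z × com TS w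

  Comp†ᴹ : M (PQS 1 †S) → M (PQS 1 †S) → M (PQS 1 †S) → Set
  Comp†ᴹ x y z = Σ (M (TS †S)) λ w → res (e₀₁ †E) w ≡ x × res (e₁₂ †E) w ≡ y × res (e₀₂ †E) w ≡ z × com (TS †S) w

  EqPath⁺ᴹ : ∀ n₁ n₂ → M (PQS (suc n₁)) → M (PQS (suc n₂)) → Set
  EqPath⁺ᴹ n₁ n₂ a b = res (stE n₁) a ≡ res (stE n₂) b × ((z : M BS) → res m₁'E z ≡ a × res m₂'E z ≡ b → com BS z)
    where open Bigon n₁ n₂

  EqPath⁺†ᴹ : ∀ n₁ n₂ → M (PQS (suc n₁) †S) → M (PQS (suc n₂) †S) → Set
  EqPath⁺†ᴹ n₁ n₂ a b =
    res (stE n₁ †E) a ≡ res (stE n₂ †E) b ×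
    ((z : M (BS †S)) → res (m₁'E †E) z ≡ a × res (m₂'E †E) z ≡ b → com (BS †S) z)
    where open Bigon n₁ n₂

  Idᴹ : M (PQS 0) → M (PQS 1) → Set
  Idᴹ x y = res σE y ≡ x ×
    ((z w : M (PQS 1)) → (Compᴹ y z w → EqPath⁺ᴹ 0 0 z w) × (Compᴹ z y w → EqPath⁺ᴹ 0 0 z w))

  Id†ᴹ : M (PQS 0) → M (PQS 1 †S) → Set
  Id†ᴹ x y = res (σE †E) y ≡ x ×
    ((z w : M (PQS 1 †S)) → (Comp†ᴹ y z w → EqPath⁺†ᴹ 0 0 z w) × (Comp†ᴹ z y w → EqPath⁺†ᴹ 0 0 z w))

  rev : ∀ k → M (PQS k †S) → M (PQS k)
  rev k = res (revPQ k)

  rev⁻ : ∀ k → M (PQS k) → M (PQS k †S)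
  rev⁻ k = res (revPQ⁻ k)

  open module RevPQ {k} = IsoAction (revPQ-iso k) using ()
    renaming (res-fwd-bwd to rev-rev⁻; res-bwd-fwd to rev⁻-rev; res-fwd-injective to rev-injective)

  module _ (n₁ n₂ : ℕ) where
    open Bigon n₁ n₂
    open BigonReversal n₁ n₂
    private
      module RevB = IsoAction revB-iso

    stE-rev : ∀ n (a : M (PQS (suc n) †S)) → res (stE n) (rev (suc n) a) ≡ res swapD₂ (res (stE n †E) a)
    stE-rev n = restr-square (revPQ-stE n)

    m₁'E-revB : ∀ z → res m₁'E (res revB z) ≡ rev k₁ (res (m₁'E †E) z)
    m₁'E-revB = restr-square revB-m₁'E

    m₂'E-revB : ∀ z → res m₂'E (res revB z) ≡ rev k₂ (res (m₂'E †E) z)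
    m₂'E-revB = restr-square revB-m₂'E

    EqPath⁺-reverse : ∀ a b → EqPath⁺†ᴹ n₁ n₂ a b ⇔ EqPath⁺ᴹ n₁ n₂ (rev k₁ a) (rev k₂ b)
    EqPath⁺-reverse a b = mk⇔ forth back
      where
      forth : EqPath⁺†ᴹ n₁ n₂ a b → EqPath⁺ᴹ n₁ n₂ (rev k₁ a) (rev k₂ b)
      forth (ends , commutes) =
        trans (stE-rev n₁ a) (trans (cong (res swapD₂) ends) (sym (stE-rev n₂ b))) ,
        λ y (y↦a , y↦b) →
          let z = res revB⁻ y
              z↦a = rev-injective (trans (sym (m₁'E-revB z)) (trans (cong (res m₁'E) (RevB.res-fwd-bwd y)) y↦a))
              z↦b = rev-injective (trans (sym (m₂'E-revB z)) (trans (cong (res m₂'E) (RevB.res-fwd-bwd y)) y↦b))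
          in subst (com BS) (RevB.res-fwd-bwd y) (commute-restr revB z (commutes z (z↦a , z↦b)))
      back : EqPath⁺ᴹ n₁ n₂ (rev k₁ a) (rev k₂ b) → EqPath⁺†ᴹ n₁ n₂ a b
      back (ends , commutes) =
        IsoAction.res-fwd-injective swapD₂-iso (trans (sym (stE-rev n₁ a)) (trans ends (stE-rev n₂ b))) ,
        λ z (z↦a , z↦b) →
          let y = res revB z
          in subst (com (BS †S)) (RevB.res-bwd-fwd z)
               (commute-restr revB⁻ y (commutes y (trans (m₁'E-revB z) (cong (rev k₁) z↦a) ,
                                                   trans (m₂'E-revB z) (cong (rev k₂) z↦b))))

  Comp†-reverse : ∀ {p q w} → Comp†ᴹ p q w → Compᴹ (rev 1 q) (rev 1 p) (rev 1 w)
  Comp†-reverse (t , t↦p , t↦q , t↦w , c) =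
    res revT t ,
    trans (restr-square revT-e₀₁ t) (cong (rev 1) t↦q) ,
    trans (restr-square revT-e₁₂ t) (cong (rev 1) t↦p) ,
    trans (restr-square revT-e₀₂ t) (cong (rev 1) t↦w) ,
    commute-restr revT t c

  Comp-reverse : ∀ {u v w} → Compᴹ u v w → Comp†ᴹ (rev⁻ 1 v) (rev⁻ 1 u) (rev⁻ 1 w)
  Comp-reverse {u} {v} {w} (s , s↦u , s↦v , s↦w , c) =
    t ,
    rev-injective (restricts e₀₁ revT-e₁₂ s↦v) ,
    rev-injective (restricts e₁₂ revT-e₀₁ s↦u) ,
    rev-injective (restricts e₀₂ revT-e₀₂ s↦w) ,
    commute-restr revT⁻ s c
    where
    t = res revT⁻ s
    restricts : ∀ {e} (e' : Emb (PQS 1) TS) {x} → Square e revT (revPQ 1) (e' †E) → res e s ≡ x →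
                rev 1 (res (e' †E) t) ≡ rev 1 (rev⁻ 1 x)
    restricts {e} e' sq s↦x =
      trans (sym (restr-square sq t))
        (trans (cong (res e) (IsoAction.res-fwd-bwd revT-iso s)) (trans s↦x (sym (rev-rev⁻ _))))

  Comp-endpoints : ∀ {x y z} → Compᴹ x y z → res σE z ≡ res σE x × res τE z ≡ res τE y
  Comp-endpoints (t , t↦x , t↦y , t↦z , _) =
    trans (cong (res σE) (sym t↦z)) (trans (restr-square e₀₂-σE t) (cong (res σE) t↦x)) ,
    trans (cong (res τE) (sym t↦z)) (trans (restr-square e₀₂-τE t) (cong (res τE) t↦y))

  EqPath⁺-endpoints : ∀ {u w} → EqPath⁺ᴹ 0 0 u w → res σE u ≡ res σE w × res τE u ≡ res τE w
  EqPath⁺-endpoints {u} {w} (ends , _) = endpoint pt₀ stE-pt₀ , endpoint pt₁ stE-pt₁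
    where
    endpoint : ∀ pt {e} → IsComp pt (stE 0) e → res e u ≡ res e w
    endpoint pt c = trans (sym (restr-comp c u)) (trans (cong (res pt) ends) (restr-comp c w))

  IdEᴹ : ∀ x → Σ (M (PQS 1)) (Idᴹ x)
  IdEᴹ = ax _ idE

  CompEᴹ : ∀ x y → res τE x ≡ res σE y → Σ (M (PQS 1)) (Compᴹ x y)
  CompEᴹ = ax _ compE

  -- As y is a unit, its composite w with an identity i at its target is parallel to i; so i starts where y does.
  Id-target : ∀ {x y} → Idᴹ x y → res τE y ≡ x
  Id-target {x} {y} (y↦x , unit) = begin
    res τE y  ≡⟨ σi≡τy ⟨
    res σE i  ≡⟨ proj₁ (EqPath⁺-endpoints (proj₁ (unit i w) C)) ⟩
    res σE w  ≡⟨ proj₁ (Comp-endpoints C) ⟩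
    res σE y  ≡⟨ y↦x ⟩
    x         ∎
    where
    open ≡-Reasoning
    i = proj₁ (IdEᴹ (res τE y))
    σi≡τy = proj₁ (proj₂ (IdEᴹ (res τE y)))
    w = proj₁ (CompEᴹ y i (sym σi≡τy))
    C = proj₂ (CompEᴹ y i (sym σi≡τy))

  Id†-target : ∀ {x z} → Id†ᴹ x z → res (τE †E) z ≡ x
  Id†-target {x} {z} (z↦x , unit) = begin
    res (τE †E) z  ≡⟨ restr-comp revPQ-σE z ⟨
    res σE y       ≡⟨ Id-target Ii ⟨
    res τE i       ≡⟨ proj₂ (EqPath⁺-endpoints i≈w) ⟩
    res τE w       ≡⟨ proj₂ (Comp-endpoints C) ⟩
    res τE y       ≡⟨ restr-comp revPQ-τE z ⟩
    res (σE †E) z  ≡⟨ z↦x ⟩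
    x              ∎
    where
    open ≡-Reasoning
    y = rev 1 z
    i = proj₁ (IdEᴹ (res σE y))
    Ii = proj₂ (IdEᴹ (res σE y))
    w = proj₁ (CompEᴹ i y (Id-target Ii))
    C = proj₂ (CompEᴹ i y (Id-target Ii))
    C† : Comp†ᴹ z (rev⁻ 1 i) (rev⁻ 1 w)
    C† = subst (λ q → Comp†ᴹ q (rev⁻ 1 i) (rev⁻ 1 w)) (rev⁻-rev z) (Comp-reverse C)
    i≈w : EqPath⁺ᴹ 0 0 i w
    i≈w = subst₂ (EqPath⁺ᴹ 0 0) (rev-rev⁻ i) (rev-rev⁻ w)
            (to (EqPath⁺-reverse 0 0 (rev⁻ 1 i) (rev⁻ 1 w)) (proj₁ (unit (rev⁻ 1 i) (rev⁻ 1 w)) C†))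

  EqPath⁺†-rev⁻ : ∀ u w → EqPath⁺†ᴹ 0 0 (rev⁻ 1 u) (rev⁻ 1 w) → EqPath⁺ᴹ 0 0 u w
  EqPath⁺†-rev⁻ u w E =
    subst₂ (EqPath⁺ᴹ 0 0) (rev-rev⁻ u) (rev-rev⁻ w) (to (EqPath⁺-reverse 0 0 (rev⁻ 1 u) (rev⁻ 1 w)) E)

  Id-reverse : ∀ x z → Id†ᴹ x z ⇔ Idᴹ x (rev 1 z)
  Id-reverse x z = mk⇔ forth back
    where
    forth : Id†ᴹ x z → Idᴹ x (rev 1 z)
    forth I@(_ , unit) = trans (restr-comp revPQ-σE z) (Id†-target I) , λ u w → left u w , right u w
      where
      left : ∀ u w → Compᴹ (rev 1 z) u w → EqPath⁺ᴹ 0 0 u w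
      left u w C = EqPath⁺†-rev⁻ u w (proj₂ (unit (rev⁻ 1 u) (rev⁻ 1 w))
                     (subst (λ q → Comp†ᴹ (rev⁻ 1 u) q (rev⁻ 1 w)) (rev⁻-rev z) (Comp-reverse C)))
      right : ∀ u w → Compᴹ u (rev 1 z) w → EqPath⁺ᴹ 0 0 u w
      right u w C = EqPath⁺†-rev⁻ u w (proj₁ (unit (rev⁻ 1 u) (rev⁻ 1 w))
                      (subst (λ q → Comp†ᴹ q (rev⁻ 1 u) (rev⁻ 1 w)) (rev⁻-rev z) (Comp-reverse C)))
    back : Idᴹ x (rev 1 z) → Id†ᴹ x z
    back I@(_ , unit) = trans (sym (restr-comp revPQ-τE z)) (Id-target I) , λ u w → left u w , right u w
      where
      left : ∀ u w → Comp†ᴹ z u w → EqPath⁺†ᴹ 0 0 u w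
      left u w C = from (EqPath⁺-reverse 0 0 u w) (proj₂ (unit (rev 1 u) (rev 1 w)) (Comp†-reverse C))
      right : ∀ u w → Comp†ᴹ u z w → EqPath⁺†ᴹ 0 0 u w
      right u w C = from (EqPath⁺-reverse 0 0 u w) (proj₁ (unit (rev 1 u) (rev 1 w)) (Comp†-reverse C))

  rev-0≗id : rev 0 ≗ id
  rev-0≗id a = trans (restr-ext (revPQ 0) (idEmb (PQS 0)) (on0 refl) (λ a ()) a) (restr-id _ a)

  EqPath₀-reverse : ∀ n a b → EqPath†ᴹ 0 (suc n) a b ⇔ EqPathᴹ 0 (suc n) (rev 0 a) (rev (suc n) b)
  EqPath₀-reverse n a b = mk⇔
    (λ (z , I , E) → rev 1 z , subst (λ q → Idᴹ q (rev 1 z)) (sym (rev-0≗id a)) (to (Id-reverse a z) I) ,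
                     to (EqPath⁺-reverse 0 n z b) E)
    (λ (y , I , E) → rev⁻ 1 y ,
       from (Id-reverse a (rev⁻ 1 y)) (subst₂ Idᴹ (rev-0≗id a) (sym (rev-rev⁻ y)) I) ,
       from (EqPath⁺-reverse 0 n (rev⁻ 1 y) b)
         (subst (λ q → EqPath⁺ᴹ 0 n q (rev (suc n) b)) (sym (rev-rev⁻ y)) E))

  EqPath-reverse : ∀ k₁ k₂ a b → EqPath†ᴹ k₁ k₂ a b ⇔ EqPathᴹ k₁ k₂ (rev k₁ a) (rev k₂ b)
  EqPath-reverse zero zero a b = mk⇔ (cong (rev 0)) (λ e → trans (sym (rev-0≗id a)) (trans e (rev-0≗id b)))
  EqPath-reverse zero (suc n) a b = EqPath₀-reverse n a b
  EqPath-reverse (suc n) zero a b = EqPath₀-reverse n b a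
  EqPath-reverse (suc n₁) (suc n₂) a b = EqPath⁺-reverse n₁ n₂ a b

  ⟦EqPath†⟧-rev : ∀ {Γ} k₁ k₂ (x : Γ ∋ PQS k₁) (y : Γ ∋ PQS k₂) ρ →
    ⟦ EqPath k₁ k₂ (var x) (var y) †F ⟧F ρ ⇔ EqPathᴹ k₁ k₂ (rev k₁ (lookupEnv ρ (†var x))) (rev k₂ (lookupEnv ρ (†var y)))
  ⟦EqPath†⟧-rev k₁ k₂ x y ρ = mk⇔
    (λ h → to (EqPath-reverse k₁ k₂ _ _) (to (⟦EqPath†⟧-var k₁ k₂ x y ρ) h))
    (λ h → from (⟦EqPath†⟧-var k₁ k₂ x y ρ) (from (EqPath-reverse k₁ k₂ _ _) h))

  -- stated for any lengths L equal to k + k', because the reversed concatenation has length k' + k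
  EqPath-concat : ∀ {k₁ k₂ k₁' k₂' L₁ L₂} → k₁ + k₁' ≡ L₁ → k₂ + k₂' ≡ L₂ →
    .(le₁ : k₁ ≤ L₁) .(le₁' : k₁' ≤ L₁) .(le₂ : k₂ ≤ L₂) .(le₂' : k₂' ≤ L₂) →
    ∀ {y₁ y₂ y₁' y₂'} → EqPathᴹ k₁ k₂ y₁ y₂ → EqPathᴹ k₁' k₂' y₁' y₂' →
    res (tpE 0 k₁ z≤n) y₁ ≡ res (spE 0 k₁' z≤n) y₁' →
    ∀ {y₁'' y₂''} → res (spE k₁ L₁ le₁) y₁'' ≡ y₁ → res (tpE k₁' L₁ le₁') y₁'' ≡ y₁' →
    res (spE k₂ L₂ le₂) y₂'' ≡ y₂ → res (tpE k₂' L₂ le₂') y₂'' ≡ y₂' → EqPathᴹ L₁ L₂ y₁'' y₂''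
  EqPath-concat {k₁} {k₂} {k₁'} {k₂'} refl refl _ _ _ _ {y₁} {y₂} {y₁'} {y₂'} y₁≈y₂ y₁'≈y₂' junction
                {y₁''} {y₂''} y₁''↦y₁ y₁''↦y₁' y₂''↦y₂ y₂''↦y₂' =
    to (⟦EqPath⟧-var (k₁ + k₁') (k₂ + k₂') (there here) here (y₂'' ∷ y₁'' ∷ ρ))
      (ax _ (eqConcat k₁ k₂ k₁' k₂') y₁ y₂ y₁' y₂'
         (from (⟦EqPath⟧-var k₁ k₂ (there (there (there here))) (there (there here)) ρ) y₁≈y₂ ,
          from (⟦EqPath⟧-var k₁' k₂' (there here) here ρ) y₁'≈y₂' , junction)
         y₁'' y₂'' ((y₁''↦y₁ , y₁''↦y₁') , (y₂''↦y₂ , y₂''↦y₂')))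
    where ρ = y₂' ∷ y₁' ∷ y₂ ∷ y₁ ∷ []

  emptyEU† : 𝓜 ⊨ (EmptyEU †F)
  emptyEU† = ax _ emptyEU

  restrComp† : ∀ {Q Q' Q''} (m : Emb Q'' Q') (m' : Emb Q' Q) (n : Emb Q'' Q) → IsComp m m' n →
               𝓜 ⊨ (RestrComp m m' n †F)
  restrComp† m m' n c = ax _ (restrComp (m †E) (m' †E) (n †E) (IsComp-† m m' n c))

  pushoutEU† : ∀ P → 𝓜 ⊨ (PushoutEU P †F)
  pushoutEU† P = ax _ (pushoutEU (PushoutConf-† P))

  compE† : 𝓜 ⊨ (CompE †F)
  compE† x y τx≡σy = rev⁻ 1 w , subst₂ (λ p q → Comp†ᴹ p q (rev⁻ 1 w)) (rev⁻-rev x) (rev⁻-rev y) (Comp-reverse C)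
    where
    composable : res τE (rev 1 y) ≡ res σE (rev 1 x)
    composable = trans (restr-comp revPQ-τE y) (trans (sym τx≡σy) (sym (restr-comp revPQ-σE x)))
    w = proj₁ (CompEᴹ (rev 1 y) (rev 1 x) composable)
    C = proj₂ (CompEᴹ (rev 1 y) (rev 1 x) composable)

  idE† : 𝓜 ⊨ (IdE †F)
  idE† x = rev⁻ 1 i , from (Id-reverse x (rev⁻ 1 i)) (subst (Idᴹ x) (sym (rev-rev⁻ i)) (proj₂ (IdEᴹ x)))
    where i = proj₁ (IdEᴹ x)

  eqRefl† : ∀ k → 𝓜 ⊨ (EqPathRefl k †F)
  eqRefl† k x = from (⟦EqPath†⟧-rev k k here here (x ∷ []))
    (to (⟦EqPath⟧-var k k here here (rev k x ∷ [])) (ax _ (eqRefl k) (rev k x)))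

  eqSym† : ∀ k₁ k₂ → 𝓜 ⊨ (EqPathSym k₁ k₂ †F)
  eqSym† k₁ k₂ x₁ x₂ h = from (⟦EqPath†⟧-rev k₂ k₁ here (there here) (x₂ ∷ x₁ ∷ []))
    (to (⟦EqPath⟧-var k₂ k₁ here (there here) ρ)
      (ax _ (eqSym k₁ k₂) (rev k₁ x₁) (rev k₂ x₂)
        (from (⟦EqPath⟧-var k₁ k₂ (there here) here ρ) (to (⟦EqPath†⟧-rev k₁ k₂ (there here) here (x₂ ∷ x₁ ∷ [])) h))))
    where ρ = rev k₂ x₂ ∷ rev k₁ x₁ ∷ []

  eqTrans† : ∀ k₁ k₂ k₃ → 𝓜 ⊨ (EqPathTrans k₁ k₂ k₃ †F)
  eqTrans† k₁ k₂ k₃ x₁ x₂ x₃ (h₁ , h₂) = from (⟦EqPath†⟧-rev k₁ k₃ (there (there here)) here ρ†)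
    (to (⟦EqPath⟧-var k₁ k₃ (there (there here)) here ρ)
      (ax _ (eqTrans k₁ k₂ k₃) (rev k₁ x₁) (rev k₂ x₂) (rev k₃ x₃)
        (from (⟦EqPath⟧-var k₁ k₂ (there (there here)) (there here) ρ)
           (to (⟦EqPath†⟧-rev k₁ k₂ (there (there here)) (there here) ρ†) h₁) ,
         from (⟦EqPath⟧-var k₂ k₃ (there here) here ρ) (to (⟦EqPath†⟧-rev k₂ k₃ (there here) here ρ†) h₂))))
    where
    ρ† = x₃ ∷ x₂ ∷ x₁ ∷ []
    ρ = rev k₃ x₃ ∷ rev k₂ x₂ ∷ rev k₁ x₁ ∷ []

  eqConcat† : ∀ k₁ k₂ k₁' k₂' → 𝓜 ⊨ (EqPathConcat k₁ k₂ k₁' k₂' †F)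
  eqConcat† k₁ k₂ k₁' k₂' x₁ x₂ x₁' x₂' (x₁≈x₂ , x₁'≈x₂' , junction) x₁'' x₂'' ((x₁''↦x₁ , x₁''↦x₁') , (x₂''↦x₂ , x₂''↦x₂')) =
    from (⟦EqPath†⟧-rev L₁ L₂ (there here) here (x₂'' ∷ x₁'' ∷ ρ†))
      (EqPath-concat (+-comm k₁' k₁) (+-comm k₂' k₂) le₁' le₁ le₂' le₂
         (to (⟦EqPath†⟧-rev k₁' k₂' (there here) here ρ†) x₁'≈x₂')
         (to (⟦EqPath†⟧-rev k₁ k₂ (there (there (there here))) (there (there here)) ρ†) x₁≈x₂)
         reversed-junction
         (prefix k₁' L₁ le₁' x₁''↦x₁') (suffix k₁ L₁ le₁ x₁''↦x₁)
         (prefix k₂' L₂ le₂' x₂''↦x₂') (suffix k₂ L₂ le₂ x₂''↦x₂))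
    where
    L₁ = k₁ + k₁'
    L₂ = k₂ + k₂'
    le₁ = m≤m+n k₁ k₁'
    le₁' = m≤n+m k₁' k₁
    le₂ = m≤m+n k₂ k₂'
    le₂' = m≤n+m k₂' k₂
    ρ† = x₂' ∷ x₁' ∷ x₂ ∷ x₁ ∷ []
    prefix : ∀ k L (le : k ≤ L) {z y} → res (tpE k L le †E) z ≡ y → res (spE k L le) (rev L z) ≡ rev k y
    prefix k L le {z} z↦y = trans (restr-square (revPQ-spE k L le) z) (cong (rev k) z↦y)
    suffix : ∀ k L (le : k ≤ L) {z y} → res (spE k L le †E) z ≡ y → res (tpE k L le) (rev L z) ≡ rev k y
    suffix k L le {z} z↦y = trans (restr-square (revPQ-tpE k L le) z) (cong (rev k) z↦y)
    reversed-junction : res (tpE 0 k₁' z≤n) (rev k₁' x₁') ≡ res (spE 0 k₁ z≤n) (rev k₁ x₁)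
    reversed-junction = begin
      res (tpE 0 k₁' z≤n) (rev k₁' x₁')   ≡⟨ restr-square (revPQ-tpE 0 k₁' z≤n) x₁' ⟩
      rev 0 (res (spE 0 k₁' z≤n †E) x₁')  ≡⟨ rev-0≗id _ ⟩
      res (spE 0 k₁' z≤n †E) x₁'          ≡⟨ junction ⟨
      res (tpE 0 k₁ z≤n †E) x₁            ≡⟨ rev-0≗id _ ⟨
      rev 0 (res (tpE 0 k₁ z≤n †E) x₁)    ≡⟨ restr-square (revPQ-spE 0 k₁ z≤n) x₁ ⟨
      res (spE 0 k₁ z≤n) (rev k₁ x₁)      ∎
      where open ≡-Reasoning

  comEq† : 𝓜 ⊨ (ComEq †F)
  comEq† x c = rev-injective (begin
    rev 1 (res (a₀E †E) x)  ≡⟨ restr-square revC₂-a₀E x ⟨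
    res a₀E (res revC₂ x)   ≡⟨ ax _ comEq (res revC₂ x) (commute-restr revC₂ x c) ⟩
    res a₁E (res revC₂ x)   ≡⟨ restr-square revC₂-a₁E x ⟩
    rev 1 (res (a₁E †E) x)  ∎)
    where open ≡-Reasoning

  pathCom† : ∀ Q → 𝓜 ⊨ (PathCom Q †F)
  pathCom† Q x =
    (λ H → to (commute⇔pathsEqual (Q †S) x) λ b' →
      let open BPair b'
          b = BPair-†⁻ b'
      in subst₂ (EqPathᴹ k₁ k₂) (restr-comp (BPair-†⁻-isComp Q k₁ vm₁ am₁ path₁) x)
                                (restr-comp (BPair-†⁻-isComp Q k₂ vm₂ am₂ path₂) x)
           (to (EqPath-reverse k₁ k₂ _ _) (to (⟦EqPath†⟧-restr k₁ k₂ (path₁ᴱ b) (path₂ᴱ b) x) (H b)))) ,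
    (λ c b →
      let open BPair b in
      from (⟦EqPath†⟧-restr k₁ k₂ (path₁ᴱ b) (path₂ᴱ b) x) (from (EqPath-reverse k₁ k₂ _ _)
        (subst₂ (EqPathᴹ k₁ k₂) (sym (restr-comp (BPair-†⁺-isComp Q k₁ vm₁ am₁ path₁) x))
                                (sym (restr-comp (BPair-†⁺-isComp Q k₂ vm₂ am₂ path₂) x))
          (from (commute⇔pathsEqual (Q †S) x) c (BPair-†⁺ b)))))

𝒯cat-selfDual : (𝓜 : Structure) → 𝓜 ⊨Th 𝒯cat → 𝓜 ⊨Th (𝒯cat †Th)
𝒯cat-selfDual 𝓜 ax _ (_ , φ∈𝒯cat , refl) = dual φ∈𝒯cat
  where
  open CatModel 𝓜 ax
  dual : ∀ {φ} → 𝒯cat φ → 𝓜 ⊨ (φ †F)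
  dual emptyEU = emptyEU†
  dual (restrComp m m' n c) = restrComp† m m' n c
  dual (pushoutEU P) = pushoutEU† P
  dual compE = compE†
  dual idE = idE†
  dual (eqRefl k) = eqRefl† k
  dual (eqSym k₁ k₂) = eqSym† k₁ k₂
  dual (eqTrans k₁ k₂ k₃) = eqTrans† k₁ k₂ k₃
  dual (eqConcat k₁ k₂ k₁' k₂') = eqConcat† k₁ k₂ k₁' k₂'
  dual comEq = comEq†
  dual (pathCom Q) = pathCom† Q

proposition25 : (𝓜 : Structure) → ExcludedMiddle 0ℓ → 𝓜 ⊨Th 𝒯ab → 𝓜 ⊨Th (𝒯ab †Th)
proposition25 𝓜 _ ax _ (_ , φ∈𝒯ab , refl) = dual φ∈𝒯ab
  where
  dual : ∀ {φ} → 𝒯ab φ → 𝓜 ⊨ (φ †F)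
  dual (cat φ∈𝒯cat) = 𝒯cat-selfDual 𝓜 (λ φ p → ax φ (cat p)) _ (_ , φ∈𝒯cat , refl)
  dual zeroE = proj₁ (ax _ zeroE) , λ y → swap (proj₂ (ax _ zeroE) y)
  dual productE = ax _ coproductE
  dual coproductE = ax _ productE
  dual kerE = ax _ cokerE
  dual cokerE = ax _ kerE
  dual monoNormal = ax _ epiNormal
  dual epiNormal = ax _ monoNormal
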